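{- Let $G$ be a finite graph, $C$ an induced cycle in $G$, and $n\geq 2$ an integer such that at most $n$ vertices of $C$ are adjacent to vertices of $G\setminus C$. Assume that $\mathbf{c}(H)\leq c$ for every induced subgraph $H$ of $G\setminus C$. Then $\mathbf{c}(G)\leq c\,\ell(n)$.
   Context: Graphs are finite and simple. The independence complex $\mathrm{Ind}(G)$ is the set of independent vertex sets of $G$ (including the empty set), regarded as a poset under inclusion. A matching on this poset is a set of disjoint pairs $\{\sigma,\tau\}$ with $\tau$ covering $\sigma$ (i.e. $\tau=\sigma\cup\{v\}$ for a vertex $v\notin\sigma$). A cycle in a matching is a sequence of $m>1$ distinct matched pairs $\{\sigma_1\subset\tau_1\},\ldots,\{\sigma_m\subset\tau_m\}$ with $\tau_i\supset\sigma_{i+1}$ for $1\le i<m$ and $\tau_m\supset\sigma_1$; a matching is acyclic if it has no cycle. Elements not in any matched pair are critical. $\mathbf{c}(G)$ denotes the minimal number of critical elements in an acyclic matching on $\mathrm{Ind}(G)$. Lucas numbers: $\varphi(0)=0,\varphi(1)=1,\varphi(n)=\varphi(n-1)+\varphi(n-2)$, and $\ell(n)=\varphi(n-1)+\varphi(n+1)$. $G\setminus C$ denotes the induced subgraph on the vertices not in $C$. -}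

module Defs where

open import Data.Bool using (Bool; true; false; _∧_; not)
open import Data.Nat using (ℕ; zero; suc; _+_; _∸_; _≤_)
open import Data.Nat.DivMod using (_%_; m%n<n)
open import Data.Fin using (Fin; toℕ; fromℕ<)
open import Data.Fin.Subset using (Subset; _∈_; _∉_; _⊆_; _⊂_; ⁅_⁆; _∪_)
open import Data.Vec using (lookup; tabulate)
open import Data.List using (List; []; _∷_; length; concatMap; allFin)
open import Data.Bool.ListAction using (any)
import Data.List.Membership.Propositional as LM
open import Data.List.Relation.Unary.All using (All)
open import Data.List.Relation.Unary.Unique.Propositional using (Unique)
open import Data.Product using (Σ; _×_; proj₁; proj₂; ∃)
open import Relation.Binary.PropositionalEquality using (_≡_)
open import Relation.Nullary using (¬_)
open import Function.Definitions using (Injective)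

fib : ℕ → ℕ
fib zero = zero
fib (suc zero) = suc zero
fib (suc (suc n)) = fib (suc n) + fib n

lucas : ℕ → ℕ
lucas n = fib (n ∸ 1) + fib (suc n)

record Graph (N : ℕ) : Set where
  field
    adj     : Fin N → Fin N → Bool
    sym     : ∀ u v → adj u v ≡ adj v u
    irrefl  : ∀ v → adj v v ≡ false
open Graph public

next : ∀ {m} → Fin m → Fin m
next {suc m} i = fromℕ< (m%n<n (suc (toℕ i)) (suc m))

IsInducedCycle : ∀ {N} → Graph N → Subset N → Set
IsInducedCycle {N} G C =
  Σ ℕ λ k → 3 ≤ k × Σ (Fin k → Fin N) λ c →
    Injective _≡_ _≡_ c
    × (∀ v → (v ∈ C → ∃ λ i → c i ≡ v) × ((∃ λ i → c i ≡ v) → v ∈ C))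
    × (∀ i j → (adj G (c i) (c j) ≡ true → (j ≡ next i Data.Sum.⊎ i ≡ next j))
             × ((j ≡ next i Data.Sum.⊎ i ≡ next j) → adj G (c i) (c j) ≡ true))
  where import Data.Sum

attach : ∀ {N} → Graph N → Subset N → Subset N
attach {N} G C = tabulate λ v →
  lookup C v ∧ any (λ u → not (lookup C u) ∧ adj G v u) (allFin N)

-- σ is an independent set of the induced subgraph G[S]
-- (so Ind(G[S]) = { σ | IndIn G S σ }, the empty set included)
IndIn : ∀ {N} → Graph N → Subset N → Subset N → Set
IndIn G S σ = σ ⊆ S × (∀ {u v} → u ∈ σ → v ∈ σ → adj G u v ≡ false)

-- a matched pair {σ ⊂ σ ∪ {v}} is encoded as (σ , v)
Pair : ℕ → Set
Pair N = Subset N × Fin N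

bot top : ∀ {N} → Pair N → Subset N
bot p = proj₁ p
top p = ⁅ proj₂ p ⁆ ∪ proj₁ p

ends : ∀ {N} → Pair N → List (Subset N)
ends p = bot p ∷ top p ∷ []

-- a matching on the poset Ind(G[S]): covering pairs, all elements distinct
IsMatching : ∀ {N} → Graph N → Subset N → List (Pair N) → Set
IsMatching G S M =
  All (λ p → proj₂ p ∉ proj₁ p × IndIn G S (top p)) M
  × Unique (concatMap ends M)

Covered : ∀ {N} → List (Pair N) → Subset N → Set
Covered M τ = τ LM.∈ concatMap ends M

-- a cycle: m > 1 distinct matched pairs with τ_i ⊃ σ_{i+1} (indices mod m)
HasCycle : ∀ {N} → List (Pair N) → Set
HasCycle {N} M =
  Σ ℕ λ m → 2 ≤ m × Σ (Fin m → Pair N) λ f →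
    (∀ i → f i LM.∈ M) × Injective _≡_ _≡_ f
    × (∀ i → bot (f (next i)) ⊂ top (f i))

Acyclic : ∀ {N} → List (Pair N) → Set
Acyclic M = ¬ HasCycle M

CriticalAtMost : ∀ {N} → Graph N → Subset N → List (Pair N) → ℕ → Set
CriticalAtMost {N} G S M k =
  Σ (List (Subset N)) λ crit → Unique crit
    × (∀ τ → (τ LM.∈ crit → IndIn G S τ × ¬ Covered M τ)
           × (IndIn G S τ × ¬ Covered M τ → τ LM.∈ crit))
    × length crit ≤ k

-- c(G[S]) ≤ k : some acyclic matching on Ind(G[S]) has at most k critical elements
cAtMost : ∀ {N} → Graph N → Subset N → ℕ → Set
cAtMost {N} G S k =
  Σ (List (Pair N)) λ M → IsMatching G S M × Acyclic M × CriticalAtMost G S M k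

module Submission where

-- The argument uses two facts about acyclic matchings on Ind(G[S]) (Matchings):
-- the splitting bound c(G[S]) ≤ c(G[S ∖ v]) + c(G[S ∖ N[v]]), obtained by gluing
-- a matching of the first complex with a copy of one of the second shifted by v,
-- and the cone lemma c(G[S]) = 0 when some v ∈ S is isolated in G[S].
-- Paths: for an induced path of C covering S ∩ C, splitting at the first vertex
-- (or at the second one when the first is unattached, which isolates the first)
-- gives c(G[S]) ≤ c·val(p), where val (Scan) is a recursive value of the pattern p
-- of attached vertices along the path.
-- Cycles: enumerate C starting from an attached vertex v₀ (if there is one) and
-- split at v₀; what remains of C are the induced paths C ∖ v₀ and C ∖ N[v₀].
-- Scan.cycle-bound shows that their values add up to at most ℓ(n): scanning a
-- pattern multiplies by the matrices F = [[1,1],[1,0]] and G = [[0,1],[1,1]], and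
-- the entries of such products obey Fibonacci/Lucas bounds (trace(Fⁱ) = ℓ(i)).

open import Defs using (Graph; cAtMost)
open import Data.Nat using (ℕ)
open import Data.Fin.Subset using (Subset; _⊆_; ∁)

-- Arithmetic: scan values of attachment patterns and the Lucas bound for a cycle.
module Scan where
  open import Defs using (fib; lucas)
  open import Data.Nat
  open import Data.Nat.Properties
  open import Data.Bool using (Bool; true; false)
  open import Data.List using (List; []; _∷_; _++_)
  open import Data.List.Properties using (++-identityʳ)
  open import Data.Product using (Σ-syntax; _×_; _,_)
  open import Relation.Binary.PropositionalEquality
  open import Relation.Nullary.Decidable using (True; toWitness)
  open import Data.Unit using (tt)
  open import Data.Nat.Tactic.RingSolver using (solve-∀)

  -- Inequalities between numerals, decided by evaluation (the instance is found
  -- because True (m ≤? n) normalises to the unit type, whose constructor tt is in scope).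
  numeral-≤ : ∀ {m n : ℕ} {{_ : True (m ≤? n)}} → m ≤ n
  numeral-≤ {{p}} = toWitness p

  suc-mono⇒mono : (f : ℕ → ℕ) → (∀ n → f n ≤ f (suc n)) → ∀ {m n} → m ≤ n → f m ≤ f n
  suc-mono⇒mono f step {m} m≤n with m≤n⇒∃[o]m+o≡n m≤n
  ... | o , refl = go o
    where
    go : ∀ o → f m ≤ f (m + o)
    go zero rewrite +-identityʳ m = ≤-refl
    go (suc o) rewrite +-suc m o = ≤-trans (go o) (step (m + o))

  fib-≤-suc : ∀ n → fib n ≤ fib (suc n)
  fib-≤-suc zero = z≤n
  fib-≤-suc (suc zero) = ≤-refl
  fib-≤-suc (suc (suc n)) = m≤m+n (fib (suc (suc n))) (fib (suc n))

  fib-mono : ∀ {m n} → m ≤ n → fib m ≤ fib n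
  fib-mono = suc-mono⇒mono fib fib-≤-suc

  lucas-rec : ∀ i → lucas (3 + i) ≡ lucas (2 + i) + lucas (1 + i)
  lucas-rec i = expand (fib i) (fib (suc i))
    where
    expand : ∀ a b → (b + a) + (((b + a) + b) + (b + a)) ≡ (b + ((b + a) + b)) + (a + (b + a))
    expand = solve-∀

  -- ℓ is monotone from 1 on (ℓ(0) = 2 > ℓ(1) = 1).
  lucas-mono : ∀ {m n} → 1 ≤ m → m ≤ n → lucas m ≤ lucas n
  lucas-mono {suc m} {suc n} _ m≤n =
    suc-mono⇒mono (λ i → lucas (suc i)) step (≤-pred m≤n)
    where
    step : ∀ i → lucas (suc i) ≤ lucas (2 + i)
    step i = +-mono-≤ (fib-≤-suc i) (fib-≤-suc (2 + i))

  3≤lucas : ∀ {n} → 2 ≤ n → 3 ≤ lucas n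
  3≤lucas 2≤n = lucas-mono {2} numeral-≤ 2≤n

  -- Scan values of an attachment pattern (true = attached vertex).  For an induced
  -- path with pattern s, c · val s bounds c(G) (see the path bound); val₁ s and
  -- val₂ s are the values after removing the first one or two vertices, except
  -- that val₂ [] = 0: a lone unattached vertex is isolated, so its graph is a cone.
  mutual
    val : List Bool → ℕ
    val [] = 1
    val (true ∷ s) = val s + val₁ s
    val (false ∷ s) = val₂ s

    val₁ : List Bool → ℕ
    val₁ [] = 1
    val₁ (_ ∷ s) = val s

    val₂ : List Bool → ℕ
    val₂ [] = 0
    val₂ (_ ∷ s) = val₁ s

  bit : Bool → ℕ
  bit true = 1
  bit false = 0

  weight : List Bool → ℕ
  weight [] = 0
  weight (b ∷ s) = bit b + weight s

  weight-snoc : ∀ s b → weight (s ++ b ∷ []) ≡ weight s + bit b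
  weight-snoc [] b = +-identityʳ (bit b)
  weight-snoc (b′ ∷ s) b = trans (cong (bit b′ +_) (weight-snoc s b)) (sym (+-assoc (bit b′) (weight s) (bit b)))

  -- Transfer vectors: val (p ++ r) is a linear form in vals r = (val r, val₁ r, val₂ r)
  -- whose coefficients are obtained by running the pattern p, bit by bit, on (1,0,0);
  -- similarly val₁ (p ++ r) starting from (0,1,0).
  V3 : Set
  V3 = ℕ × ℕ × ℕ

  dot : V3 → V3 → ℕ
  dot (x , y , z) (u , v , w) = x * u + y * v + z * w

  vals : List Bool → V3
  vals s = (val s , val₁ s , val₂ s)

  step : Bool → V3 → V3
  step true (x , y , z) = (x + y , x + z , 0)
  step false (x , y , z) = (y , z , x)

  run : V3 → List Bool → V3
  run v [] = v
  run v (b ∷ p) = run (step b v) p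

  dot-run : ∀ v p r → dot v (vals (p ++ r)) ≡ dot (run v p) (vals r)
  dot-run v [] r = refl
  dot-run (x , y , z) (true ∷ p) r =
    trans (regroup x y z (val (p ++ r)) (val₁ (p ++ r)) (val₂ (p ++ r))) (dot-run (x + y , x + z , 0) p r)
    where
    regroup : ∀ x y z u v w → x * (u + v) + y * u + z * v ≡ (x + y) * u + (x + z) * v + 0 * w
    regroup = solve-∀
  dot-run (x , y , z) (false ∷ p) r =
    trans (rotate x y z (val (p ++ r)) (val₁ (p ++ r)) (val₂ (p ++ r))) (dot-run (y , z , x) p r)
    where
    rotate : ∀ x y z u v w → x * w + y * u + z * v ≡ y * u + z * v + x * w
    rotate = solve-∀

  -- Along the scan each coefficient vector keeps a zero coordinate, and an attached
  -- vertex acts on the two others, (a, b), by one of the matrices F = [[1,1],[1,0]]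
  -- or G = [[0,1],[1,1]].  EntryBounds i collects bounds on the entries of a matrix
  -- [[a,c],[b,d]] that is a product of i + 1 factors F or G; the trace bound
  -- a + d ≤ ℓ(i+1) is the heart of the matter (ℓ(i+1) is the trace of F^(i+1)), the
  -- other bounds keep the induction going.
  record EntryBounds (i a b c d : ℕ) : Set where
    field
      a≤ : a ≤ fib (2 + i)
      b≤ : b ≤ fib (2 + i)
      a+b≤ : a + b ≤ fib (3 + i)
      c≤ : c ≤ fib (2 + i)
      d≤ : d ≤ fib (2 + i)
      c+d≤ : c + d ≤ fib (3 + i)
      a+d≤ : a + d ≤ lucas (1 + i)
      a+b+c≤ : a + b + c ≤ lucas (2 + i)
      b+c+d≤ : b + c + d ≤ lucas (2 + i)
      2b≤ : b + b ≤ lucas (2 + i)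
      2c≤ : c + c ≤ lucas (2 + i)

  fib-up : ∀ {x} i → x ≤ fib (2 + i) → x ≤ fib (3 + i)
  fib-up i h = ≤-trans h (fib-≤-suc (2 + i))

  double-fib₁ : ∀ j → fib (suc j) + fib (suc j) ≤ lucas (2 + j)
  double-fib₁ j = +-monoʳ-≤ (fib (suc j)) (fib-mono (≤-trans (n≤1+n (suc j)) (n≤1+n (2 + j))))

  double-fib₂ : ∀ j → fib (2 + j) + fib (2 + j) ≤ lucas (2 + j)
  double-fib₂ j = ≤-trans (+-monoʳ-≤ (fib (2 + j)) (+-monoʳ-≤ (fib (suc j)) (fib-≤-suc j)))
                          (≤-reflexive (expand (fib j) (fib (suc j))))
    where
    expand : ∀ a b → (b + a) + (b + b) ≡ b + ((b + a) + b)
    expand = solve-∀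

  lucas-sum : ∀ {x y z} i → x ≡ y + z → y ≤ lucas (2 + i) → z ≤ lucas (1 + i) → x ≤ lucas (3 + i)
  lucas-sum i refl y≤ z≤ = ≤-trans (+-mono-≤ y≤ z≤) (≤-reflexive (sym (lucas-rec i)))

  bounds-F : ∀ {i a b c d} → EntryBounds i a b c d → EntryBounds (suc i) (a + b) a (c + d) c
  bounds-F {i} {a} {b} {c} {d} B = record
    { a≤ = a+b≤ ; b≤ = fib-up i a≤ ; a+b≤ = +-mono-≤ a+b≤ a≤
    ; c≤ = c+d≤ ; d≤ = fib-up i c≤ ; c+d≤ = +-mono-≤ c+d≤ c≤
    ; a+d≤ = a+b+c≤
    ; a+b+c≤ = lucas-sum i (expand₁ a b c d) a+b+c≤ a+d≤
    ; b+c+d≤ = lucas-sum i (expand₂ a c d) 2c≤ a+d≤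
    ; 2b≤ = ≤-trans (+-mono-≤ a≤ a≤) (double-fib₁ (suc i))
    ; 2c≤ = ≤-trans (+-mono-≤ c+d≤ c+d≤) (double-fib₂ (suc i))
    }
    where
    open EntryBounds B
    expand₁ : ∀ a b c d → a + b + a + (c + d) ≡ (a + b + c) + (a + d)
    expand₁ = solve-∀
    expand₂ : ∀ a c d → a + (c + d) + c ≡ (c + c) + (a + d)
    expand₂ = solve-∀

  bounds-G : ∀ {i a b c d} → EntryBounds i a b c d → EntryBounds (suc i) b (a + b) d (c + d)
  bounds-G {i} {a} {b} {c} {d} B = record
    { a≤ = fib-up i b≤ ; b≤ = a+b≤ ; a+b≤ = ≤-trans (≤-reflexive (+-comm b (a + b))) (+-mono-≤ a+b≤ b≤)
    ; c≤ = fib-up i d≤ ; d≤ = c+d≤ ; c+d≤ = ≤-trans (≤-reflexive (+-comm d (c + d))) (+-mono-≤ c+d≤ d≤)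
    ; a+d≤ = ≤-trans (≤-reflexive (sym (+-assoc b c d))) b+c+d≤
    ; a+b+c≤ = lucas-sum i (expand₁ a b d) 2b≤ a+d≤
    ; b+c+d≤ = lucas-sum i (expand₂ a b c d) b+c+d≤ a+d≤
    ; 2b≤ = ≤-trans (+-mono-≤ a+b≤ a+b≤) (double-fib₂ (suc i))
    ; 2c≤ = ≤-trans (+-mono-≤ d≤ d≤) (double-fib₁ (suc i))
    }
    where
    open EntryBounds B
    expand₁ : ∀ a b d → b + (a + b) + d ≡ (b + b) + (a + d)
    expand₁ = solve-∀
    expand₂ : ∀ a b c d → a + b + d + (c + d) ≡ (b + c + d) + (a + d)
    expand₂ = solve-∀

  bounds-F₀ : EntryBounds 0 1 1 1 0
  bounds-F₀ = record { a≤ = numeral-≤ ; b≤ = numeral-≤ ; a+b≤ = numeral-≤ ; c≤ = numeral-≤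
                     ; d≤ = numeral-≤ ; c+d≤ = numeral-≤ ; a+d≤ = numeral-≤ ; a+b+c≤ = numeral-≤
                     ; b+c+d≤ = numeral-≤ ; 2b≤ = numeral-≤ ; 2c≤ = numeral-≤ }

  bounds-G₀ : EntryBounds 0 0 1 1 1
  bounds-G₀ = record { a≤ = numeral-≤ ; b≤ = numeral-≤ ; a+b≤ = numeral-≤ ; c≤ = numeral-≤
                     ; d≤ = numeral-≤ ; c+d≤ = numeral-≤ ; a+d≤ = numeral-≤ ; a+b+c≤ = numeral-≤
                     ; b+c+d≤ = numeral-≤ ; 2b≤ = numeral-≤ ; 2c≤ = numeral-≤ }

  data ProductBounds : ℕ → ℕ → ℕ → ℕ → ℕ → Set where
    empty-product : ProductBounds 0 1 0 0 1
    bounded : ∀ {i a b c d} → EntryBounds i a b c d → ProductBounds (suc i) a b c d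

  product-F : ∀ {j a b c d} → ProductBounds j a b c d → ProductBounds (suc j) (a + b) a (c + d) c
  product-F empty-product = bounded bounds-F₀
  product-F (bounded B) = bounded (bounds-F B)

  product-G : ∀ {j a b c d} → ProductBounds j a b c d → ProductBounds (suc j) b (a + b) d (c + d)
  product-G empty-product = bounded bounds-G₀
  product-G (bounded B) = bounded (bounds-G B)

  -- After scanning a prefix, the coefficient vectors X = run (1,0,0) p of val and
  -- Y = run (0,1,0) p of val₁ have their zero in the same coordinate, and their
  -- other coordinates are the columns (a,b) and (c,d) of one matrix.
  data Shape : V3 → V3 → ℕ → ℕ → ℕ → ℕ → Set where
    zero₂ : ∀ {a b c d} → Shape (a , b , 0) (c , d , 0) a b c d
    zero₁ : ∀ {a b c d} → Shape (b , 0 , a) (d , 0 , c) a b c d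
    zero₀ : ∀ {a b c d} → Shape (0 , a , b) (0 , c , d) a b c d

  ScanState : V3 → V3 → ℕ → Set
  ScanState X Y m = Σ[ j ∈ ℕ ] Σ[ a ∈ ℕ ] Σ[ b ∈ ℕ ] Σ[ c ∈ ℕ ] Σ[ d ∈ ℕ ]
    j ≤ m × Shape X Y a b c d × ProductBounds j a b c d

  state-false : ∀ {X Y m} → ScanState X Y m → ScanState (step false X) (step false Y) m
  state-false (j , a , b , c , d , j≤m , zero₂ , P) = j , a , b , c , d , j≤m , zero₁ , P
  state-false (j , a , b , c , d , j≤m , zero₁ , P) = j , a , b , c , d , j≤m , zero₀ , P
  state-false (j , a , b , c , d , j≤m , zero₀ , P) = j , a , b , c , d , j≤m , zero₂ , P

  state-true : ∀ {X Y m} → ScanState X Y m → ScanState (step true X) (step true Y) (suc m)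
  state-true (j , a , b , c , d , j≤m , zero₂ , P) =
    suc j , a + b , a , c + d , c , s≤s j≤m ,
    subst₂ (λ u w → Shape (a + b , u , 0) (c + d , w , 0) (a + b) a (c + d) c)
           (sym (+-identityʳ a)) (sym (+-identityʳ c)) zero₂ ,
    product-F P
  state-true (j , a , b , c , d , j≤m , zero₁ , P) =
    suc j , b , a + b , d , c + d , s≤s j≤m ,
    subst₂ (λ u w → Shape u w b (a + b) d (c + d))
           (cong₂ (λ p q → (p , q , 0)) (sym (+-identityʳ b)) (+-comm a b))
           (cong₂ (λ p q → (p , q , 0)) (sym (+-identityʳ d)) (+-comm c d)) zero₂ ,
    product-G P
  state-true (j , a , b , c , d , j≤m , zero₀ , P) = j , a , b , c , d , m≤n⇒m≤1+n j≤m , zero₂ , P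

  state-run : ∀ {X Y m} p → ScanState X Y m → ScanState (run X p) (run Y p) (m + weight p)
  state-run {m = m} [] S rewrite +-identityʳ m = S
  state-run {m = m} (true ∷ p) S rewrite +-suc m (weight p) = state-run p (state-true S)
  state-run (false ∷ p) S = state-run p (state-false S)

  state-init : ScanState (1 , 0 , 0) (0 , 1 , 0) 0
  state-init = 0 , 1 , 0 , 0 , 1 , z≤n , zero₂ , empty-product

  final-value-empty : ∀ {X Y} z → Shape X Y 1 0 0 1 → dot X (vals (z ∷ [])) + dot Y (vals []) ≤ 3
  final-value-empty false zero₂ = numeral-≤
  final-value-empty false zero₁ = numeral-≤
  final-value-empty false zero₀ = numeral-≤
  final-value-empty true zero₂ = numeral-≤
  final-value-empty true zero₁ = numeral-≤
  final-value-empty true zero₀ = numeral-≤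

  final-value : ∀ {X Y i a b c d} z → Shape X Y a b c d → EntryBounds i a b c d →
            dot X (vals (z ∷ [])) + dot Y (vals []) ≤ lucas (bit z + (2 + i))
  final-value {i = i} {a} {b} {c} {d} false zero₂ B = ≤-trans (≤-reflexive (expand a b c d)) (EntryBounds.b+c+d≤ B)
    where
    expand : ∀ a b c d → a * 0 + b * 1 + 0 * 1 + (c * 1 + d * 1 + 0 * 0) ≡ b + c + d
    expand = solve-∀
  final-value {i = i} {a} {b} {c} {d} false zero₁ B =
    ≤-trans (≤-reflexive (expand a b c d)) (≤-trans (EntryBounds.a+d≤ B) (lucas-mono (s≤s z≤n) (n≤1+n (suc i))))
    where
    expand : ∀ a b c d → b * 0 + 0 * 1 + a * 1 + (d * 1 + 0 * 1 + c * 0) ≡ a + d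
    expand = solve-∀
  final-value {i = i} {a} {b} {c} {d} false zero₀ B = ≤-trans (≤-reflexive (expand a b c d)) (EntryBounds.a+b+c≤ B)
    where
    expand : ∀ a b c d → 0 * 0 + a * 1 + b * 1 + (0 * 1 + c * 1 + d * 0) ≡ a + b + c
    expand = solve-∀
  final-value {i = i} {a} {b} {c} {d} true zero₂ B =
    lucas-sum i (expand a b c d) (EntryBounds.a+b+c≤ B) (EntryBounds.a+d≤ B)
    where
    expand : ∀ a b c d → a * 2 + b * 1 + 0 * 1 + (c * 1 + d * 1 + 0 * 0) ≡ (a + b + c) + (a + d)
    expand = solve-∀
  final-value {i = i} {a} {b} {c} {d} true zero₁ B =
    lucas-sum i (expand a b c d) (EntryBounds.2b≤ B) (EntryBounds.a+d≤ B)
    where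
    expand : ∀ a b c d → b * 2 + 0 * 1 + a * 1 + (d * 1 + 0 * 1 + c * 0) ≡ (b + b) + (a + d)
    expand = solve-∀
  final-value {i = i} {a} {b} {c} {d} true zero₀ B =
    ≤-trans (≤-reflexive (expand a b c d)) (≤-trans (EntryBounds.a+b+c≤ B) (lucas-mono (s≤s z≤n) (n≤1+n (2 + i))))
    where
    expand : ∀ a b c d → 0 * 2 + a * 1 + b * 1 + (0 * 1 + c * 1 + d * 0) ≡ a + b + c
    expand = solve-∀

  -- The arithmetic heart of the theorem: for a cycle whose first vertex is attached
  -- (or with no attached vertex at all), p ++ [z] the pattern of the remaining
  -- vertices, the two paths produced by splitting at the first vertex have values
  -- summing to at most ℓ(n).
  cycle-bound : ∀ p z n → 2 ≤ n → weight p + 1 + bit z ≤ n → val (p ++ z ∷ []) + val₁ p ≤ lucas n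
  cycle-bound p z n 2≤n bound =
    ≤-trans (≤-reflexive (cong₂ _+_ first second)) (close (state-run p state-init))
    where
    first-coordinate : ∀ u v w → 1 * u + 0 * v + 0 * w ≡ u
    first-coordinate = solve-∀
    second-coordinate : ∀ u v w → 0 * u + 1 * v + 0 * w ≡ v
    second-coordinate = solve-∀
    first : val (p ++ z ∷ []) ≡ dot (run (1 , 0 , 0) p) (vals (z ∷ []))
    first = trans (sym (first-coordinate (val (p ++ z ∷ [])) (val₁ (p ++ z ∷ [])) (val₂ (p ++ z ∷ [])))) (dot-run (1 , 0 , 0) p (z ∷ []))
    second : val₁ p ≡ dot (run (0 , 1 , 0) p) (vals [])
    second = trans (sym (second-coordinate (val p) _ (val₂ p)))
                   (trans (cong (λ q → dot (0 , 1 , 0) (vals q)) (sym (++-identityʳ p))) (dot-run (0 , 1 , 0) p []))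
    index : ∀ i → suc i ≤ weight p → bit z + (2 + i) ≤ n
    index i i<w = ≤-trans (≤-reflexive (+-comm (bit z) (2 + i)))
                          (≤-trans (+-monoˡ-≤ (bit z) (≤-trans (s≤s i<w) (≤-reflexive (+-comm 1 (weight p))))) bound)
    close : ∀ {X Y} → ScanState X Y (0 + weight p) → dot X (vals (z ∷ [])) + dot Y (vals []) ≤ lucas n
    close (_ , _ , _ , _ , _ , _ , S , empty-product) = ≤-trans (final-value-empty z S) (3≤lucas 2≤n)
    close (suc i , _ , _ , _ , _ , j≤m , S , bounded B) =
      ≤-trans (final-value z S B) (lucas-mono (≤-trans (s≤s z≤n) (m≤n+m (2 + i) (bit z))) (index i j≤m))

module Cyclic where
  open import Defs using (next)
  open import Data.Nat using (ℕ; zero; suc; _+_; _∸_; _≤_; _<_; z≤n; s≤s)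
  open import Data.Nat.Properties
  open import Data.Nat.DivMod using (_%_; m<n⇒m%n≡m; n%n≡0)
  open import Data.Fin using (Fin; toℕ; fromℕ<) renaming (zero to fzero)
  open import Data.Fin.Properties using (toℕ-fromℕ<; toℕ-injective; toℕ<n)
  open import Data.Product using (∃; _×_; _,_)
  open import Data.Sum using (_⊎_; inj₁; inj₂)
  open import Data.Empty using (⊥-elim)
  open import Relation.Nullary using (¬_; yes; no)
  open import Relation.Binary.PropositionalEquality
  open ≡-Reasoning

  module _ {m : ℕ} where

    next-cases : ∀ (i : Fin (suc m)) → toℕ (next i) ≡ suc (toℕ i) ⊎ (toℕ i ≡ m × toℕ (next i) ≡ 0)
    next-cases i with suc (toℕ i) <? suc m
    ... | yes lt = inj₁ (trans (toℕ-fromℕ< _) (m<n⇒m%n≡m lt))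
    ... | no ¬lt = inj₂ (i≡m , trans (toℕ-fromℕ< _) (trans (cong (λ t → suc t % suc m) i≡m) (n%n≡0 (suc m))))
      where
      i≡m : toℕ i ≡ m
      i≡m = ≤-antisym (≤-pred (toℕ<n i)) (≤-pred (≮⇒≥ ¬lt))

    next-toℕ : ∀ (i : Fin (suc m)) → toℕ i < m → toℕ (next i) ≡ suc (toℕ i)
    next-toℕ i i<m with next-cases i
    ... | inj₁ e = e
    ... | inj₂ (i≡m , _) = ⊥-elim (<-irrefl i≡m i<m)

    next-injective : ∀ {i j : Fin (suc m)} → next i ≡ next j → i ≡ j
    next-injective {i} {j} e with next-cases i | next-cases j
    ... | inj₁ ei | inj₁ ej = toℕ-injective (suc-injective (trans (sym ei) (trans (cong toℕ e) ej)))
    ... | inj₁ ei | inj₂ (_ , ej) = ⊥-elim (1+n≢0 (trans (sym ei) (trans (cong toℕ e) ej)))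
    ... | inj₂ (_ , ei) | inj₁ ej = ⊥-elim (1+n≢0 (trans (sym ej) (trans (cong toℕ (sym e)) ei)))
    ... | inj₂ (i≡m , _) | inj₂ (j≡m , _) = toℕ-injective (trans i≡m (sym j≡m))

    shift : ℕ → Fin (suc m) → Fin (suc m)
    shift zero i = i
    shift (suc r) i = next (shift r i)

    shift-next : ∀ r i → shift r (next i) ≡ next (shift r i)
    shift-next zero i = refl
    shift-next (suc r) i = cong next (shift-next r i)

    shift-+ : ∀ r s i → shift (r + s) i ≡ shift r (shift s i)
    shift-+ zero s i = refl
    shift-+ (suc r) s i = cong next (shift-+ r s i)

    shift-injective : ∀ r {i j} → shift r i ≡ shift r j → i ≡ j
    shift-injective zero e = e
    shift-injective (suc r) e = shift-injective r (next-injective e)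

    toℕ-shift : ∀ r i → toℕ i + r < suc m → toℕ (shift r i) ≡ toℕ i + r
    toℕ-shift zero i _ = sym (+-identityʳ (toℕ i))
    toℕ-shift (suc r) i lt = begin
      toℕ (next (shift r i)) ≡⟨ next-toℕ (shift r i) (subst (_< m) (sym (toℕ-shift r i lt′)) i+r<m) ⟩
      suc (toℕ (shift r i))  ≡⟨ cong suc (toℕ-shift r i lt′) ⟩
      suc (toℕ i + r)        ≡⟨ sym (+-suc (toℕ i) r) ⟩
      toℕ i + suc r          ∎
      where
      i+r<m : toℕ i + r < m
      i+r<m = ≤-pred (subst (_< suc m) (+-suc (toℕ i) r) lt)
      lt′ : toℕ i + r < suc m
      lt′ = m<n⇒m<1+n i+r<m

    shift-from-zero : ∀ (k : Fin (suc m)) → shift (toℕ k) fzero ≡ k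
    shift-from-zero k = toℕ-injective (toℕ-shift (toℕ k) fzero (toℕ<n k))

    next-last : ∀ (i : Fin (suc m)) → toℕ i ≡ m → toℕ (next i) ≡ 0
    next-last i i≡m with next-cases i
    ... | inj₁ e = ⊥-elim (<-irrefl (trans e (cong suc i≡m)) (toℕ<n (next i)))
    ... | inj₂ (_ , e) = e

    shift-to-zero : ∀ (i : Fin (suc m)) → shift (suc (m ∸ toℕ i)) i ≡ fzero
    shift-to-zero i = toℕ-injective (next-last (shift (m ∸ toℕ i) i) reaches-last)
      where
      i≤m : toℕ i ≤ m
      i≤m = ≤-pred (toℕ<n i)
      reaches-last : toℕ (shift (m ∸ toℕ i) i) ≡ m
      reaches-last = trans (toℕ-shift (m ∸ toℕ i) i (s≤s (≤-reflexive (m+[n∸m]≡n i≤m)))) (m+[n∸m]≡n i≤m)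

    shift-connects : ∀ (i k : Fin (suc m)) → ∃ λ r → shift r i ≡ k
    shift-connects i k = toℕ k + suc (m ∸ toℕ i) , (begin
      shift (toℕ k + suc (m ∸ toℕ i)) i     ≡⟨ shift-+ (toℕ k) (suc (m ∸ toℕ i)) i ⟩
      shift (toℕ k) (shift (suc (m ∸ toℕ i)) i) ≡⟨ cong (shift (toℕ k)) (shift-to-zero i) ⟩
      shift (toℕ k) fzero                    ≡⟨ shift-from-zero k ⟩
      k                                      ∎)

    shift-surjective : ∀ r (j : Fin (suc m)) → ∃ λ i → shift r i ≡ j
    shift-surjective r j with shift-connects (shift r fzero) j
    ... | s , e = shift s fzero , (begin
      shift r (shift s fzero) ≡⟨ sym (shift-+ r s fzero) ⟩
      shift (r + s) fzero     ≡⟨ cong (λ t → shift t fzero) (+-comm r s) ⟩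
      shift (s + r) fzero     ≡⟨ shift-+ s r fzero ⟩
      shift s (shift r fzero) ≡⟨ e ⟩
      j                       ∎)

    next-closed : (P : Fin (suc m) → Set) → (∀ i → P i → P (next i)) → ∀ {i} → P i → ∀ k → P k
    next-closed P closed {i} Pi k with shift-connects i k
    ... | r , refl = along r
      where
      along : ∀ r → P (shift r i)
      along zero = Pi
      along (suc r) = closed (shift r i) (along r)

    no-descent : (h : Fin (suc m) → ℕ) → ¬ (∀ i → h (next i) < h i)
    no-descent h decreasing = <-irrefl refl (<-≤-trans (m≤n+m (suc (h fzero)) _) (drop (suc (h fzero))))
      where
      drop : ∀ r → h (shift r fzero) + r ≤ h fzero
      drop zero = ≤-reflexive (+-identityʳ _)
      drop (suc r) = ≤-trans (≤-reflexive (+-suc (h (shift (suc r) fzero)) r))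
                             (≤-trans (+-monoˡ-≤ r (decreasing (shift r fzero))) (drop r))

  next-≢ : ∀ {m} (i : Fin (suc (suc m))) → next i ≢ i
  next-≢ i e with next-cases i
  ... | inj₁ e′ = 1+n≢n (trans (sym e′) (cong toℕ e))
  ... | inj₂ (i≡m , e′) = 1+n≢0 (trans (sym i≡m) (trans (sym (cong toℕ e)) e′))

  -- The list of indices a, a+1, …, a+len-1 in Fin K (the bound is irrelevant, so
  -- ranges built from different proofs are equal).
  module Range (K : ℕ) where
    open import Data.List using (List; []; _∷_; _++_)
    open import Data.List.Membership.Propositional using () renaming (_∈_ to _∈ₗ_; _∉_ to _∉ₗ_)
    open import Data.List.Relation.Unary.Any using (here; there)
    open import Data.List.Relation.Unary.All.Properties using (¬Any⇒All¬)
    open import Data.List.Relation.Unary.Unique.Propositional using (Unique)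
    open import Data.List.Relation.Unary.AllPairs using ([]; _∷_)
    open import Data.Fin.Properties using (toℕ-fromℕ<)

    step-bound : ∀ a len → a + suc len ≤ K → suc a + len ≤ K
    step-bound a len = subst (_≤ K) (+-suc a len)

    range : ∀ a len → .(a + len ≤ K) → List (Fin K)
    range a zero _ = []
    range a (suc len) h = fromℕ< (<-≤-trans (m<m+n a (s≤s z≤n)) h) ∷ range (suc a) len (step-bound a len h)

    ∈-range⁻ : ∀ a len .(h : a + len ≤ K) {i} → i ∈ₗ range a len h → a ≤ toℕ i × toℕ i < a + len
    ∈-range⁻ a (suc len) h (here refl) =
      ≤-reflexive (sym (toℕ-fromℕ< _)) , subst (_< a + suc len) (sym (toℕ-fromℕ< _)) (m<m+n a (s≤s z≤n))
    ∈-range⁻ a (suc len) h {i} (there i∈) with ∈-range⁻ (suc a) len (step-bound a len h) i∈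
    ... | a<i , i< = <⇒≤ a<i , subst (toℕ i <_) (sym (+-suc a len)) i<

    ∈-range⁺ : ∀ a len .(h : a + len ≤ K) {i} → a ≤ toℕ i → toℕ i < a + len → i ∈ₗ range a len h
    ∈-range⁺ a zero h a≤i i< = ⊥-elim (<-irrefl refl (<-≤-trans i< (≤-trans (≤-reflexive (+-identityʳ a)) a≤i)))
    ∈-range⁺ a (suc len) h {i} a≤i i< with toℕ i ≟ a
    ... | yes i≡a = here (toℕ-injective (trans i≡a (sym (toℕ-fromℕ< _))))
    ... | no i≢a = there (∈-range⁺ (suc a) len _ (≤∧≢⇒< a≤i (λ e → i≢a (sym e))) (subst (toℕ i <_) (+-suc a len) i<))

    range-unique : ∀ a len .(h : a + len ≤ K) → Unique (range a len h)
    range-unique a zero h = []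
    range-unique a (suc len) h = ¬Any⇒All¬ _ fresh ∷ range-unique (suc a) len _
      where
      fresh : fromℕ< _ ∉ₗ range (suc a) len _
      fresh i∈ with ∈-range⁻ (suc a) len (step-bound a len h) i∈
      ... | a<i , _ = <-irrefl (sym (toℕ-fromℕ< _)) a<i

    range-snoc : ∀ a len .(h : a + suc len ≤ K) .(h′ : a + len ≤ K) .(lt : a + len < K) →
                 range a (suc len) h ≡ range a len h′ ++ (fromℕ< lt ∷ [])
    range-snoc a zero h h′ lt =
      cong (_∷ []) (toℕ-injective (trans (toℕ-fromℕ< _) (trans (sym (+-identityʳ a)) (sym (toℕ-fromℕ< _)))))
    range-snoc a (suc len) h h′ lt =
      cong (fromℕ< (<-≤-trans (m<m+n a (s≤s z≤n)) h) ∷_)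
           (trans (range-snoc (suc a) len (step-bound a (suc len) h) (step-bound a len h′) (subst (_< K) (+-suc a len) lt))
                  (cong (λ i → range (suc a) len (step-bound a len h′) ++ (i ∷ []))
                                      (toℕ-injective (trans (toℕ-fromℕ< _) (trans (sym (+-suc a len)) (sym (toℕ-fromℕ< _)))))))

module Sets where
  open import Defs renaming (sym to adj-sym)
  open import Data.Nat using (ℕ)
  open import Data.Bool using (Bool; true; false; _∨_)
  open import Data.Fin using (Fin; _≟_)
  open import Data.Fin.Subset
  open import Data.Fin.Subset.Properties
  open import Data.Fin.Properties using (any?)
  open import Data.Vec using (lookup; tabulate; here; there; _∷_)
  open import Data.Vec.Properties using ([]=⇒lookup; lookup⇒[]=; lookup∘tabulate)
  open import Data.List using (List; []; _∷_; map)
  open import Data.List.Relation.Unary.All using (All; []; _∷_)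
  open import Data.List.Relation.Unary.Unique.Propositional using (Unique)
  open import Data.List.Relation.Unary.AllPairs using ([]; _∷_)
  open import Data.Product using (_×_; _,_; proj₁)
  open import Data.Sum using (_⊎_; inj₁; inj₂)
  open import Data.Empty using (⊥-elim)
  open import Relation.Nullary using (yes; no; ¬?; _×-dec_)
  open import Relation.Nullary.Decidable using (⌊_⌋)
  open import Relation.Binary.PropositionalEquality

  map-unique : ∀ {A B : Set} (f : A → B) (P : A → Set) {xs : List A} → All P xs →
               (∀ {x y} → P x → P y → f x ≡ f y → x ≡ y) → Unique xs → Unique (map f xs)
  map-unique f P [] _ [] = []
  map-unique f P {x ∷ xs} (px ∷ pxs) inj (x∉ ∷ u) = distinct pxs x∉ ∷ map-unique f P pxs inj u
    where
    distinct : ∀ {ys} → All P ys → All (x ≢_) ys → All (f x ≢_) (map f ys)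
    distinct [] [] = []
    distinct (py ∷ pys) (x≢y ∷ x≢ys) = (λ e → x≢y (inj px py e)) ∷ distinct pys x≢ys

  x∈p─q⇒x∉q : ∀ {n} {x : Fin n} (p q : Subset n) → x ∈ p ─ q → x ∉ q
  x∈p─q⇒x∉q (inside ∷ p) (outside ∷ q) here ()
  x∈p─q⇒x∉q (_ ∷ p) (_ ∷ q) (there x∈p─q) (there x∈q) = x∈p─q⇒x∉q p q x∈p─q x∈q

  module _ {N : ℕ} where

    ∈-tabulate⁻ : ∀ {f : Fin N → Bool} {x} → x ∈ tabulate f → f x ≡ true
    ∈-tabulate⁻ {f} {x} x∈ = trans (sym (lookup∘tabulate f x)) ([]=⇒lookup x∈)

    ∈-tabulate⁺ : ∀ {f : Fin N → Bool} {x} → f x ≡ true → x ∈ tabulate f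
    ∈-tabulate⁺ {f} {x} fx = lookup⇒[]= x _ (trans (lookup∘tabulate f x) fx)

    ∉-tabulate⁻ : ∀ {f : Fin N → Bool} {x} → x ∉ tabulate f → f x ≡ false
    ∉-tabulate⁻ {f} {x} x∉ with f x in fx
    ... | true = ⊥-elim (x∉ (∈-tabulate⁺ fx))
    ... | false = refl

    lookup-cong : ∀ {A B : Subset N} x → (x ∈ A → x ∈ B) → (x ∈ B → x ∈ A) → lookup A x ≡ lookup B x
    lookup-cong {A} {B} x A⊆B B⊆A = agree (lookup A x) (lookup B x) refl refl
      where
      agree : ∀ a b → lookup A x ≡ a → lookup B x ≡ b → a ≡ b
      agree true true _ _ = refl
      agree false false _ _ = refl
      agree true false a b = trans (sym ([]=⇒lookup (A⊆B (lookup⇒[]= x A a)))) b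
      agree false true a b = trans (sym a) ([]=⇒lookup (B⊆A (lookup⇒[]= x B b)))

    ⊆∧≢⇒⊂ : ∀ {p q : Subset N} → p ⊆ q → p ≢ q → p ⊂ q
    ⊆∧≢⇒⊂ {p} {q} p⊆q p≢q with any? (λ x → (x ∈? q) ×-dec ¬? (x ∈? p))
    ... | yes (x , x∈q , x∉p) = p⊆q , x , x∈q , x∉p
    ... | no no-witness = ⊥-elim (p≢q (⊆-antisym p⊆q q⊆p))
      where
      q⊆p : q ⊆ p
      q⊆p {x} x∈q with x ∈? p
      ... | yes x∈p = x∈p
      ... | no x∉p = ⊥-elim (no-witness (x , x∈q , x∉p))

    ∈-insert⁻ : ∀ {v x} {σ : Subset N} → x ∈ ⁅ v ⁆ ∪ σ → x ≡ v ⊎ x ∈ σ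
    ∈-insert⁻ {v} {σ = σ} x∈ with x∈p∪q⁻ ⁅ v ⁆ σ x∈
    ... | inj₁ x∈v = inj₁ (x∈⁅y⁆⇒x≡y v x∈v)
    ... | inj₂ x∈σ = inj₂ x∈σ

    ∈-insert-new : ∀ {v} {σ : Subset N} → v ∈ ⁅ v ⁆ ∪ σ
    ∈-insert-new {v} = x∈p∪q⁺ (inj₁ (x∈⁅x⁆ v))

    ∈-insert-old : ∀ {v x} {σ : Subset N} → x ∈ σ → x ∈ ⁅ v ⁆ ∪ σ
    ∈-insert-old x∈σ = x∈p∪q⁺ (inj₂ x∈σ)

    ∈-delete⁻ : ∀ {v x} {σ : Subset N} → x ∈ σ - v → x ∈ σ × x ≢ v
    ∈-delete⁻ {v} {σ = σ} x∈ =
      p─q⊆p σ ⁅ v ⁆ x∈ , λ { refl → x∈p─q⇒x∉q σ ⁅ v ⁆ x∈ (x∈⁅x⁆ v) }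

    ∈-delete⁺ : ∀ {v x} {σ : Subset N} → x ∈ σ → x ≢ v → x ∈ σ - v
    ∈-delete⁺ = x∈p∧x≢y⇒x∈p-y

    delete-insert : ∀ {v} {σ : Subset N} → v ∉ σ → (⁅ v ⁆ ∪ σ) - v ≡ σ
    delete-insert {v} {σ} v∉σ = ⊆-antisym forward backward
      where
      forward : (⁅ v ⁆ ∪ σ) - v ⊆ σ
      forward x∈ with ∈-delete⁻ x∈
      ... | x∈′ , x≢v with ∈-insert⁻ x∈′
      ... | inj₁ x≡v = ⊥-elim (x≢v x≡v)
      ... | inj₂ x∈σ = x∈σ
      backward : σ ⊆ (⁅ v ⁆ ∪ σ) - v
      backward x∈σ = ∈-delete⁺ (∈-insert-old x∈σ) λ { refl → v∉σ x∈σ }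

    insert-delete : ∀ {v} {τ : Subset N} → v ∈ τ → ⁅ v ⁆ ∪ (τ - v) ≡ τ
    insert-delete {v} {τ} v∈τ = ⊆-antisym forward backward
      where
      forward : ⁅ v ⁆ ∪ (τ - v) ⊆ τ
      forward x∈ with ∈-insert⁻ x∈
      ... | inj₁ refl = v∈τ
      ... | inj₂ x∈τ-v = proj₁ (∈-delete⁻ x∈τ-v)
      backward : τ ⊆ ⁅ v ⁆ ∪ (τ - v)
      backward {x} x∈τ with x ≟ v
      ... | yes refl = ∈-insert-new
      ... | no x≢v = ∈-insert-old (∈-delete⁺ x∈τ x≢v)

    insert-injective : ∀ {v} {σ σ′ : Subset N} → v ∉ σ → v ∉ σ′ → ⁅ v ⁆ ∪ σ ≡ ⁅ v ⁆ ∪ σ′ → σ ≡ σ′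
    insert-injective {v} v∉σ v∉σ′ e =
      trans (sym (delete-insert v∉σ)) (trans (cong (_- v) e) (delete-insert v∉σ′))

    insert-comm : ∀ (u v : Fin N) σ → ⁅ u ⁆ ∪ (⁅ v ⁆ ∪ σ) ≡ ⁅ v ⁆ ∪ (⁅ u ⁆ ∪ σ)
    insert-comm u v σ = trans (sym (∪-assoc ⁅ u ⁆ ⁅ v ⁆ σ))
                              (trans (cong (_∪ σ) (∪-comm ⁅ u ⁆ ⁅ v ⁆)) (∪-assoc ⁅ v ⁆ ⁅ u ⁆ σ))

  module Neighbourhood {N : ℕ} (G : Graph N) where

    N[_] : Fin N → Subset N
    N[ v ] = tabulate λ u → ⌊ u ≟ v ⌋ ∨ adj G v u

    ∈-─N⁻ : ∀ {S v x} → x ∈ S ─ N[ v ] → x ∈ S × x ≢ v × adj G v x ≡ false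
    ∈-─N⁻ {S} {v} {x} x∈ with x ≟ v | ∉-tabulate⁻ {f = λ u → ⌊ u ≟ v ⌋ ∨ adj G v u} (x∈p─q⇒x∉q S N[ v ] x∈)
    ... | yes _ | ()
    ... | no x≢v | ¬adj = p─q⊆p S N[ v ] x∈ , x≢v , ¬adj

    ∈-─N⁺ : ∀ {S v x} → x ∈ S → x ≢ v → adj G v x ≡ false → x ∈ S ─ N[ v ]
    ∈-─N⁺ {S} {v} {x} x∈S x≢v ¬adj = x∈p∧x∉q⇒x∈p─q x∈S x∉N[v]
      where
      x∉N[v] : x ∉ N[ v ]
      x∉N[v] x∈ with x ≟ v | ∈-tabulate⁻ {f = λ u → ⌊ u ≟ v ⌋ ∨ adj G v u} x∈
      ... | yes x≡v | _ = x≢v x≡v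
      ... | no _ | adj≡true with trans (sym adj≡true) ¬adj
      ... | ()

-- Acyclic matchings of independence complexes: the splitting bound and the cone lemma.
module Matchings where
  open import Defs renaming (sym to adj-sym)
  open Sets
  open Cyclic using (next-closed; no-descent; next-≢)
  open import Data.Nat using (ℕ; zero; suc; _+_; _≤_; _<_; z≤n; s≤s)
  import Data.Nat.Properties as ℕP
  open import Data.Fin using (Fin)
  open import Data.Bool using (false)
  open import Data.Fin.Properties using (any?)
  open import Data.Fin.Subset
  open import Data.Fin.Subset.Properties
  open import Data.List using (List; []; _∷_; _++_; length; map; concatMap)
  open import Data.List.Properties using (length-++; length-map)
  open import Data.List.Membership.Propositional using () renaming (_∈_ to _∈ₗ_; _∉_ to _∉ₗ_)
  open import Data.List.Membership.Propositional.Properties using (∈-map⁺; ∈-map⁻; ∈-++⁺ˡ; ∈-++⁺ʳ; ∈-++⁻)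
  open import Data.List.Relation.Unary.Any using (here; there)
  open import Data.List.Relation.Unary.All as All using (All; []; _∷_)
  import Data.List.Relation.Unary.All.Properties as All
  open import Data.List.Relation.Unary.Unique.Propositional using (Unique)
  open import Data.List.Relation.Unary.AllPairs using ([]; _∷_)
  open import Data.List.Relation.Unary.Unique.Propositional.Properties using (++⁺)
  open import Data.Product using (Σ; ∃; _×_; _,_; proj₁; proj₂)
  open import Data.Sum using (_⊎_; inj₁; inj₂)
  open import Data.Empty using (⊥-elim)
  open import Relation.Nullary using (¬_; yes; no; ¬?)
  open import Relation.Binary.PropositionalEquality
  open import Function.Definitions using (Injective)

  module _ {N : ℕ} where

    ∈-ends⁻ : ∀ {τ} (M : List (Pair N)) → τ ∈ₗ concatMap ends M → ∃ λ p → p ∈ₗ M × (τ ≡ bot p ⊎ τ ≡ top p)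
    ∈-ends⁻ (p ∷ M) (here e) = p , here refl , inj₁ e
    ∈-ends⁻ (p ∷ M) (there (here e)) = p , here refl , inj₂ e
    ∈-ends⁻ (p ∷ M) (there (there τ∈)) with ∈-ends⁻ M τ∈
    ... | q , q∈M , e = q , there q∈M , e

    bot∈ends : ∀ {p} {M : List (Pair N)} → p ∈ₗ M → bot p ∈ₗ concatMap ends M
    bot∈ends (here refl) = here refl
    bot∈ends (there p∈M) = there (there (bot∈ends p∈M))

    top∈ends : ∀ {p} {M : List (Pair N)} → p ∈ₗ M → top p ∈ₗ concatMap ends M
    top∈ends (here refl) = there (here refl)
    top∈ends (there p∈M) = there (there (top∈ends p∈M))

    ends-++ : ∀ (M M′ : List (Pair N)) → concatMap ends (M ++ M′) ≡ concatMap ends M ++ concatMap ends M′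
    ends-++ [] M′ = refl
    ends-++ (p ∷ M) M′ = cong (λ l → bot p ∷ top p ∷ l) (ends-++ M M′)

    lift : Fin N → Pair N → Pair N
    lift v (σ , u) = (⁅ v ⁆ ∪ σ , u)

    ends-lift : ∀ v (M : List (Pair N)) → concatMap ends (map (lift v) M) ≡ map (⁅ v ⁆ ∪_) (concatMap ends M)
    ends-lift v [] = refl
    ends-lift v ((σ , u) ∷ M) = cong₂ (λ τ l → (⁅ v ⁆ ∪ σ) ∷ τ ∷ l) (insert-comm u v σ) (ends-lift v M)

    cells-split⁻ : ∀ v (M₁ M₂ : List (Pair N)) {τ} → Covered (M₁ ++ map (lift v) M₂) τ →
                   Covered M₁ τ ⊎ ∃ λ κ → Covered M₂ κ × τ ≡ ⁅ v ⁆ ∪ κ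
    cells-split⁻ v M₁ M₂ τ∈ rewrite ends-++ M₁ (map (lift v) M₂) | ends-lift v M₂ with ∈-++⁻ (concatMap ends M₁) τ∈
    ... | inj₁ τ∈₁ = inj₁ τ∈₁
    ... | inj₂ τ∈₂ = inj₂ (∈-map⁻ (⁅ v ⁆ ∪_) τ∈₂)

    cells-split₁ : ∀ v (M₁ M₂ : List (Pair N)) {τ} → Covered M₁ τ → Covered (M₁ ++ map (lift v) M₂) τ
    cells-split₁ v M₁ M₂ τ∈ rewrite ends-++ M₁ (map (lift v) M₂) = ∈-++⁺ˡ τ∈

    cells-split₂ : ∀ v (M₁ M₂ : List (Pair N)) {κ} → Covered M₂ κ → Covered (M₁ ++ map (lift v) M₂) (⁅ v ⁆ ∪ κ)
    cells-split₂ v M₁ M₂ κ∈ rewrite ends-++ M₁ (map (lift v) M₂) | ends-lift v M₂ =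
      ∈-++⁺ʳ (concatMap ends M₁) (∈-map⁺ (⁅ v ⁆ ∪_) κ∈)

    bot⊆top : ∀ (p : Pair N) → bot p ⊆ top p
    bot⊆top (σ , u) = ∈-insert-old

    ++-insert-unique : ∀ {v} {xs ys : List (Subset N)} → Unique xs → Unique ys →
                       (∀ {σ} → σ ∈ₗ xs → v ∉ σ) → (∀ {σ} → σ ∈ₗ ys → v ∉ σ) → Unique (xs ++ map (⁅ v ⁆ ∪_) ys)
    ++-insert-unique {v} {xs} {ys} unique-xs unique-ys v∉xs v∉ys =
      ++⁺ unique-xs (map-unique (⁅ v ⁆ ∪_) (v ∉_) (All.tabulate v∉ys) insert-injective unique-ys) disjoint
      where
      disjoint : ∀ {τ} → ¬ (τ ∈ₗ xs × τ ∈ₗ map (⁅ v ⁆ ∪_) ys)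
      disjoint (τ∈xs , τ∈ys) with ∈-map⁻ (⁅ v ⁆ ∪_) τ∈ys
      ... | _ , _ , refl = v∉xs τ∈xs ∈-insert-new

    cone-pair : Fin N → Subset N → Pair N
    cone-pair v σ = (σ , v)

    cone-cells⁻ : ∀ {v τ} L → τ ∈ₗ concatMap ends (map (cone-pair v) L) → ∃ λ σ → σ ∈ₗ L × (τ ≡ σ ⊎ τ ≡ ⁅ v ⁆ ∪ σ)
    cone-cells⁻ {v} L τ∈ with ∈-ends⁻ (map (cone-pair v) L) τ∈
    ... | p , p∈ , e with ∈-map⁻ (cone-pair v) p∈
    ... | σ , σ∈ , refl = σ , σ∈ , e

    cone-cells-unique : ∀ v L → Unique L → (∀ {σ} → σ ∈ₗ L → v ∉ σ) → Unique (concatMap ends (map (cone-pair v) L))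
    cone-cells-unique v [] _ _ = []
    cone-cells-unique v (σ ∷ L) (σ∉L ∷ unique) v∉ =
      ((λ e → v∉ (here refl) (subst (v ∈_) (sym e) ∈-insert-new)) ∷ All.¬Any⇒All¬ _ σ-fresh) ∷
      All.¬Any⇒All¬ _ vσ-fresh ∷ cone-cells-unique v L unique (λ σ∈ → v∉ (there σ∈))
      where
      σ-fresh : σ ∉ₗ concatMap ends (map (cone-pair v) L)
      σ-fresh σ∈ with cone-cells⁻ L σ∈
      ... | σ′ , σ′∈ , inj₁ refl = All.lookup σ∉L σ′∈ refl
      ... | σ′ , σ′∈ , inj₂ refl = v∉ (here refl) ∈-insert-new
      vσ-fresh : ⁅ v ⁆ ∪ σ ∉ₗ concatMap ends (map (cone-pair v) L)
      vσ-fresh vσ∈ with cone-cells⁻ L vσ∈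
      ... | σ′ , σ′∈ , inj₁ e = v∉ (there σ′∈) (subst (v ∈_) e ∈-insert-new)
      ... | σ′ , σ′∈ , inj₂ e = All.lookup σ∉L σ′∈ (insert-injective (v∉ (here refl)) (v∉ (there σ′∈)) e)

    -- A cone matching is acyclic: along a cycle the bottoms would strictly shrink,
    -- since σ′ ⊂ σ ∪ {v} with v ∉ σ′ forces σ′ ⊆ σ, and σ′ ≠ σ for distinct pairs.
    cone-acyclic : ∀ v L → (∀ {σ} → σ ∈ₗ L → v ∉ σ) → Acyclic (map (cone-pair v) L)
    cone-acyclic v L v∉L (suc zero , s≤s () , _)
    cone-acyclic v L v∉L (suc (suc k) , _ , f , f∈ , f-inj , f-step) = no-descent (λ i → ∣ bot (f i) ∣) shrinks
      where
      from-L : ∀ i → ∃ λ σ → σ ∈ₗ L × f i ≡ cone-pair v σ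
      from-L i = ∈-map⁻ (cone-pair v) (f∈ i)
      f≡ : ∀ i → f i ≡ cone-pair v (bot (f i))
      f≡ i with from-L i
      ... | σ , _ , refl = refl
      v∉bot : ∀ i → v ∉ bot (f i)
      v∉bot i with from-L i
      ... | σ , σ∈ , refl = v∉L σ∈
      shrinks : ∀ i → ∣ bot (f (next i)) ∣ < ∣ bot (f i) ∣
      shrinks i = p⊂q⇒∣p∣<∣q∣ (⊆∧≢⇒⊂ ⊆bot distinct)
        where
        ⊆bot : bot (f (next i)) ⊆ bot (f i)
        ⊆bot x∈ with ∈-insert⁻ (subst (λ p → bot (f (next i)) ⊆ top p) (f≡ i) (proj₁ (f-step i)) x∈)
        ... | inj₁ refl = ⊥-elim (v∉bot (next i) x∈)
        ... | inj₂ x∈bot = x∈bot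
        distinct : bot (f (next i)) ≢ bot (f i)
        distinct e = next-≢ i (f-inj (trans (f≡ (next i)) (trans (cong (cone-pair v) e) (sym (f≡ i)))))

    module _ (G : Graph N) where
      open Neighbourhood G

      independent-⊆ : ∀ {S σ σ′} → σ′ ⊆ σ → IndIn G S σ → IndIn G S σ′
      independent-⊆ σ′⊆σ (σ⊆S , ind) = (λ x∈ → σ⊆S (σ′⊆σ x∈)) , (λ u∈ v∈ → ind (σ′⊆σ u∈) (σ′⊆σ v∈))

      independent-widen : ∀ {S T σ} → S ⊆ T → IndIn G S σ → IndIn G T σ
      independent-widen S⊆T (σ⊆S , ind) = (λ x∈ → S⊆T (σ⊆S x∈)) , ind

      cell-independent : ∀ {T M} → IsMatching G T M → ∀ {τ} → τ ∈ₗ concatMap ends M → IndIn G T τ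
      cell-independent {M = M} (pairs , _) τ∈ with ∈-ends⁻ M τ∈
      ... | p , p∈M , inj₁ refl = independent-⊆ (bot⊆top p) (proj₂ (All.lookup pairs p∈M))
      ... | p , p∈M , inj₂ refl = proj₂ (All.lookup pairs p∈M)

      v∉-delete : ∀ {S v τ} → IndIn G (S - v) τ → v ∉ τ
      v∉-delete (τ⊆ , _) v∈τ = proj₂ (∈-delete⁻ (τ⊆ v∈τ)) refl

      v∉-─N : ∀ {S v τ} → IndIn G (S ─ N[ v ]) τ → v ∉ τ
      v∉-─N (τ⊆ , _) v∈τ = proj₁ (proj₂ (∈-─N⁻ (τ⊆ v∈τ))) refl

      insert-independent : ∀ {S v τ} → v ∈ S → IndIn G (S ─ N[ v ]) τ → IndIn G S (⁅ v ⁆ ∪ τ)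
      insert-independent {S} {v} {τ} v∈S (τ⊆ , ind) = ⊆S , ind′
        where
        ⊆S : ⁅ v ⁆ ∪ τ ⊆ S
        ⊆S x∈ with ∈-insert⁻ x∈
        ... | inj₁ refl = v∈S
        ... | inj₂ x∈τ = proj₁ (∈-─N⁻ (τ⊆ x∈τ))
        ind′ : ∀ {a b} → a ∈ ⁅ v ⁆ ∪ τ → b ∈ ⁅ v ⁆ ∪ τ → adj G a b ≡ false
        ind′ {a} a∈ b∈ with ∈-insert⁻ a∈ | ∈-insert⁻ b∈
        ... | inj₁ refl | inj₁ refl = irrefl G v
        ... | inj₁ refl | inj₂ b∈τ = proj₂ (proj₂ (∈-─N⁻ (τ⊆ b∈τ)))
        ... | inj₂ a∈τ | inj₁ refl = trans (adj-sym G a v) (proj₂ (proj₂ (∈-─N⁻ (τ⊆ a∈τ))))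
        ... | inj₂ a∈τ | inj₂ b∈τ = ind a∈τ b∈τ

      independent-delete : ∀ {S v τ} → v ∉ τ → IndIn G S τ → IndIn G (S - v) τ
      independent-delete {τ = τ} v∉τ (τ⊆ , ind) = (λ {x} x∈ → ∈-delete⁺ (τ⊆ x∈) λ { refl → v∉τ x∈ }) , ind

      independent-link : ∀ {S v τ} → v ∈ τ → IndIn G S τ → IndIn G (S ─ N[ v ]) (τ - v)
      independent-link v∈τ (τ⊆ , ind) =
        (λ x∈ → let (x∈τ , x≢v) = ∈-delete⁻ x∈ in ∈-─N⁺ (τ⊆ x∈τ) x≢v (ind v∈τ x∈τ)) ,
        (λ a∈ b∈ → ind (proj₁ (∈-delete⁻ a∈)) (proj₁ (∈-delete⁻ b∈)))

      split-matching : ∀ {S v M₁ M₂} → v ∈ S → IsMatching G (S - v) M₁ → IsMatching G (S ─ N[ v ]) M₂ →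
                       IsMatching G S (M₁ ++ map (lift v) M₂)
      split-matching {S} {v} {M₁} {M₂} v∈S m₁@(pairs₁ , unique₁) m₂@(pairs₂ , unique₂) =
        All.++⁺ (All.map pair₁ pairs₁) (All.map⁺ (All.map pair₂ pairs₂)) , unique
        where
        pair₁ : ∀ {p : Pair N} → proj₂ p ∉ proj₁ p × IndIn G (S - v) (top p) → proj₂ p ∉ proj₁ p × IndIn G S (top p)
        pair₁ (u∉σ , ind) = u∉σ , independent-widen (p─q⊆p S ⁅ v ⁆) ind
        pair₂ : ∀ {p : Pair N} → proj₂ p ∉ proj₁ p × IndIn G (S ─ N[ v ]) (top p) →
                proj₂ (lift v p) ∉ proj₁ (lift v p) × IndIn G S (top (lift v p))
        pair₂ {σ , u} (u∉σ , ind) = u∉vσ , subst (IndIn G S) (sym (insert-comm u v σ)) (insert-independent v∈S ind)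
          where
          u∉vσ : u ∉ ⁅ v ⁆ ∪ σ
          u∉vσ u∈ with ∈-insert⁻ u∈
          ... | inj₁ refl = v∉-─N ind ∈-insert-new
          ... | inj₂ u∈σ = u∉σ u∈σ
        unique : Unique (concatMap ends (M₁ ++ map (lift v) M₂))
        unique rewrite ends-++ M₁ (map (lift v) M₂) | ends-lift v M₂ =
          ++-insert-unique unique₁ unique₂ (λ τ∈ → v∉-delete (cell-independent m₁ τ∈)) (λ τ∈ → v∉-─N (cell-independent m₂ τ∈))

      split-critical : ∀ {S v M₁ M₂ a b} → v ∈ S → IsMatching G (S - v) M₁ → IsMatching G (S ─ N[ v ]) M₂ →
                       CriticalAtMost G (S - v) M₁ a → CriticalAtMost G (S ─ N[ v ]) M₂ b →
                       CriticalAtMost G S (M₁ ++ map (lift v) M₂) (a + b)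
      split-critical {S} {v} {M₁} {M₂} {a} {b} v∈S m₁ m₂ (crit₁ , unique₁ , char₁ , len₁) (crit₂ , unique₂ , char₂ , len₂) =
        crit₁ ++ map (⁅ v ⁆ ∪_) crit₂ , unique , (λ τ → critical τ , complete τ) , length-bound
        where
        M : List (Pair N)
        M = M₁ ++ map (lift v) M₂
        unique : Unique (crit₁ ++ map (⁅ v ⁆ ∪_) crit₂)
        unique = ++-insert-unique unique₁ unique₂ (λ τ∈ → v∉-delete (proj₁ (proj₁ (char₁ _) τ∈)))
                                                  (λ κ∈ → v∉-─N (proj₁ (proj₁ (char₂ _) κ∈)))
        critical : ∀ τ → τ ∈ₗ crit₁ ++ map (⁅ v ⁆ ∪_) crit₂ → IndIn G S τ × ¬ Covered M τ
        critical τ τ∈ with ∈-++⁻ crit₁ τ∈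
        ... | inj₁ τ∈₁ = independent-widen (p─q⊆p S ⁅ v ⁆) ind , uncovered
          where
          ind : IndIn G (S - v) τ
          ind = proj₁ (proj₁ (char₁ τ) τ∈₁)
          uncovered : ¬ Covered M τ
          uncovered c with cells-split⁻ v M₁ M₂ c
          ... | inj₁ c₁ = proj₂ (proj₁ (char₁ τ) τ∈₁) c₁
          ... | inj₂ (_ , _ , refl) = v∉-delete ind ∈-insert-new
        ... | inj₂ τ∈₂ with ∈-map⁻ (⁅ v ⁆ ∪_) τ∈₂
        ... | κ , κ∈ , refl = insert-independent v∈S ind , uncovered
          where
          ind : IndIn G (S ─ N[ v ]) κ
          ind = proj₁ (proj₁ (char₂ κ) κ∈)
          uncovered : ¬ Covered M (⁅ v ⁆ ∪ κ)
          uncovered c with cells-split⁻ v M₁ M₂ c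
          ... | inj₁ c₁ = v∉-delete (cell-independent m₁ c₁) ∈-insert-new
          ... | inj₂ (κ′ , c₂ , e) =
            proj₂ (proj₁ (char₂ κ) κ∈) (subst (Covered M₂) (sym (insert-injective (v∉-─N ind) (v∉-─N (cell-independent m₂ c₂)) e)) c₂)
        complete : ∀ τ → IndIn G S τ × ¬ Covered M τ → τ ∈ₗ crit₁ ++ map (⁅ v ⁆ ∪_) crit₂
        complete τ (ind , uncovered) with v ∈? τ
        ... | no v∉τ = ∈-++⁺ˡ (proj₂ (char₁ τ) (independent-delete v∉τ ind , λ c → uncovered (cells-split₁ v M₁ M₂ c)))
        ... | yes v∈τ = subst (_∈ₗ crit₁ ++ map (⁅ v ⁆ ∪_) crit₂) (insert-delete v∈τ)
            (∈-++⁺ʳ crit₁ (∈-map⁺ (⁅ v ⁆ ∪_) (proj₂ (char₂ (τ - v))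
              (independent-link v∈τ ind , λ c → uncovered (subst (Covered M) (insert-delete v∈τ) (cells-split₂ v M₁ M₂ c))))))
        length-bound : length (crit₁ ++ map (⁅ v ⁆ ∪_) crit₂) ≤ a + b
        length-bound rewrite length-++ crit₁ {map (⁅ v ⁆ ∪_) crit₂} | length-map (⁅ v ⁆ ∪_) crit₂ = ℕP.+-mono-≤ len₁ len₂

      unlift : Fin N → Pair N → Pair N
      unlift v (σ , u) = (σ - v , u)

      ⊂-unlift : ∀ {v u : Fin N} {A B} → u ≢ v → v ∈ A → A ⊂ ⁅ u ⁆ ∪ B → A - v ⊂ ⁅ u ⁆ ∪ (B - v)
      ⊂-unlift {v} {u} {A} {B} u≢v v∈A (A⊆ , y , y∈ , y∉A) = ⊆′ , y , y∈′ , (λ y∈A-v → y∉A (proj₁ (∈-delete⁻ y∈A-v)))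
        where
        ⊆′ : A - v ⊆ ⁅ u ⁆ ∪ (B - v)
        ⊆′ x∈ with ∈-delete⁻ x∈
        ... | x∈A , x≢v with ∈-insert⁻ (A⊆ x∈A)
        ... | inj₁ refl = ∈-insert-new
        ... | inj₂ x∈B = ∈-insert-old (∈-delete⁺ x∈B x≢v)
        y∈′ : y ∈ ⁅ u ⁆ ∪ (B - v)
        y∈′ with ∈-insert⁻ y∈
        ... | inj₁ refl = ∈-insert-new
        ... | inj₂ y∈B = ∈-insert-old (∈-delete⁺ y∈B λ { refl → y∉A v∈A })

      -- A cycle of the split matching with one bottom avoiding v lies in M₁: such a
      -- pair comes from M₁, so its top avoids v and hence so does the next bottom.
      cycle-in-M₁ : ∀ {S v M₁ M₂ m} → IsMatching G (S - v) M₁ → (f : Fin (suc m) → Pair N) →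
                    (∀ i → f i ∈ₗ M₁ ++ map (lift v) M₂) → (∀ i → bot (f (next i)) ⊂ top (f i)) →
                    ∀ {i₀} → v ∉ bot (f i₀) → ∀ i → f i ∈ₗ M₁
      cycle-in-M₁ {S} {v} {M₁} {M₂} m₁ f f∈ f-step v∉ i = in-M₁ i (next-closed (λ i → v ∉ bot (f i)) step v∉ i)
        where
        in-M₁ : ∀ i → v ∉ bot (f i) → f i ∈ₗ M₁
        in-M₁ i v∉ with ∈-++⁻ M₁ (f∈ i)
        ... | inj₁ f∈₁ = f∈₁
        ... | inj₂ f∈₂ with ∈-map⁻ (lift v) f∈₂
        ... | q , _ , e = ⊥-elim (v∉ (subst (λ p → v ∈ bot p) (sym e) ∈-insert-new))
        step : ∀ i → v ∉ bot (f i) → v ∉ bot (f (next i))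
        step i v∉ v∈ = v∉-delete (proj₂ (All.lookup (proj₁ m₁) (in-M₁ i v∉))) (proj₁ (f-step i) v∈)

      cycle-from-M₂ : ∀ {S v M₁ M₂ k} → IsMatching G (S - v) M₁ → IsMatching G (S ─ N[ v ]) M₂ →
                      (f : Fin (suc (suc k)) → Pair N) → (∀ i → f i ∈ₗ M₁ ++ map (lift v) M₂) → Injective _≡_ _≡_ f →
                      (∀ i → bot (f (next i)) ⊂ top (f i)) → (∀ i → v ∈ bot (f i)) → HasCycle M₂
      cycle-from-M₂ {S} {v} {M₁} {M₂} {k} m₁ m₂ f f∈ f-inj f-step contains = suc (suc k) , s≤s (s≤s z≤n) , g , g∈ , g-inj , g-step
        where
        from-M₂ : ∀ i → ∃ λ q → q ∈ₗ M₂ × f i ≡ lift v q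
        from-M₂ i with ∈-++⁻ M₁ (f∈ i)
        ... | inj₁ f∈₁ = ⊥-elim (v∉-delete (independent-⊆ (bot⊆top (f i)) (proj₂ (All.lookup (proj₁ m₁) f∈₁))) (contains i))
        ... | inj₂ f∈₂ = ∈-map⁻ (lift v) f∈₂
        g : Fin (suc (suc k)) → Pair N
        g i = unlift v (f i)
        unlift-lift : ∀ q → q ∈ₗ M₂ → unlift v (lift v q) ≡ q
        unlift-lift (σ , u) q∈ = cong (_, u) (delete-insert (v∉-─N (independent-⊆ (bot⊆top (σ , u)) (proj₂ (All.lookup (proj₁ m₂) q∈)))))
        g≡ : ∀ i → g i ≡ proj₁ (from-M₂ i)
        g≡ i with from-M₂ i
        ... | q , q∈ , e = trans (cong (unlift v) e) (unlift-lift q q∈)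
        g∈ : ∀ i → g i ∈ₗ M₂
        g∈ i = subst (_∈ₗ M₂) (sym (g≡ i)) (proj₁ (proj₂ (from-M₂ i)))
        f≡ : ∀ i → f i ≡ lift v (g i)
        f≡ i = trans (proj₂ (proj₂ (from-M₂ i))) (cong (lift v) (sym (g≡ i)))
        g-inj : Injective _≡_ _≡_ g
        g-inj {i} {j} e = f-inj (trans (f≡ i) (trans (cong (lift v) e) (sym (f≡ j))))
        u≢v : ∀ i → proj₂ (f i) ≢ v
        u≢v i u≡v with from-M₂ i
        ... | (σ , u) , q∈ , e = proj₁ (proj₂ (∈-─N⁻ (proj₁ (proj₂ (All.lookup (proj₁ m₂) q∈)) ∈-insert-new)))
                                   (trans (sym (cong proj₂ e)) u≡v)
        g-step : ∀ i → bot (g (next i)) ⊂ top (g i)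
        g-step i = ⊂-unlift (u≢v i) (contains (next i)) (f-step i)

      -- Either some bottom of a cycle avoids v, or all contain it.
      split-acyclic : ∀ {S v M₁ M₂} → IsMatching G (S - v) M₁ → IsMatching G (S ─ N[ v ]) M₂ →
                      Acyclic M₁ → Acyclic M₂ → Acyclic (M₁ ++ map (lift v) M₂)
      split-acyclic m₁ m₂ acyclic₁ acyclic₂ (suc zero , s≤s () , _)
      split-acyclic {v = v} m₁ m₂ acyclic₁ acyclic₂ (suc (suc k) , 2≤ , f , f∈ , f-inj , f-step)
        with any? (λ i → ¬? (v ∈? bot (f i)))
      ... | yes (_ , v∉) = acyclic₁ (suc (suc k) , 2≤ , f , cycle-in-M₁ m₁ f f∈ f-step v∉ , f-inj , f-step)
      ... | no none-avoid = acyclic₂ (cycle-from-M₂ m₁ m₂ f f∈ f-inj f-step contains)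
        where
        contains : ∀ i → v ∈ bot (f i)
        contains i with v ∈? bot (f i)
        ... | yes v∈ = v∈
        ... | no v∉ = ⊥-elim (none-avoid (i , v∉))

      vertex-split : ∀ {S v a b} → v ∈ S → cAtMost G (S - v) a → cAtMost G (S ─ N[ v ]) b → cAtMost G S (a + b)
      vertex-split v∈S (M₁ , m₁ , acyclic₁ , crit₁) (M₂ , m₂ , acyclic₂ , crit₂) =
        M₁ ++ map (lift _) M₂ , split-matching v∈S m₁ m₂ , split-acyclic m₁ m₂ acyclic₁ acyclic₂ ,
        split-critical v∈S m₁ m₂ crit₁ crit₂

      cAtMost-weaken : ∀ {S a b} → cAtMost G S a → a ≤ b → cAtMost G S b
      cAtMost-weaken (M , m , acyclic , (crit , unique , char , len)) a≤b =
        M , m , acyclic , (crit , unique , char , ℕP.≤-trans len a≤b)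

      -- With no pairs every independent set is critical, so splitting with empty
      -- matchings lists Ind(G[S]), by induction on ∣ S ∣.
      empty-set-critical : ∀ {S} → Empty S → CriticalAtMost G S [] 1
      empty-set-critical {S} S-empty = ⊥ ∷ [] , ([] ∷ []) , (λ τ → critical τ , complete τ) , ℕP.≤-refl
        where
        critical : ∀ τ → τ ∈ₗ ⊥ ∷ [] → IndIn G S τ × ¬ Covered [] τ
        critical τ (here refl) = ((λ x∈ → ⊥-elim (∉⊥ x∈)) , (λ x∈ _ → ⊥-elim (∉⊥ x∈))) , λ ()
        complete : ∀ τ → IndIn G S τ × ¬ Covered [] τ → τ ∈ₗ ⊥ ∷ []
        complete τ ((τ⊆S , _) , _) = here (⊆-antisym (λ {x} x∈ → ⊥-elim (S-empty (x , τ⊆S x∈))) ⊥⊆)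

      list-independent : ∀ k S → ∣ S ∣ ≤ k → Σ ℕ λ a → CriticalAtMost G S [] a
      list-independent k S _ with nonempty? S
      ... | no S-empty = 1 , empty-set-critical S-empty
      list-independent zero S ∣S∣≤0 | yes (v , v∈S) = ⊥-elim (ℕP.n≮0 (ℕP.<-≤-trans (x∈p⇒∣p-x∣<∣p∣ v∈S) ∣S∣≤0))
      list-independent (suc k) S ∣S∣≤ | yes (v , v∈S)
        with list-independent k (S - v) ∣S-v∣≤k | list-independent k (S ─ N[ v ]) (ℕP.≤-trans ∣S─N∣≤∣S-v∣ ∣S-v∣≤k)
        where
        ∣S-v∣≤k : ∣ S - v ∣ ≤ k
        ∣S-v∣≤k = ℕP.≤-pred (ℕP.<-≤-trans (x∈p⇒∣p-x∣<∣p∣ v∈S) ∣S∣≤)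
        ∣S─N∣≤∣S-v∣ : ∣ S ─ N[ v ] ∣ ≤ ∣ S - v ∣
        ∣S─N∣≤∣S-v∣ = p⊆q⇒∣p∣≤∣q∣ (λ x∈ → let (x∈S , x≢v , _) = ∈-─N⁻ {S} {v} x∈ in ∈-delete⁺ x∈S x≢v)
      ... | a , crit₁ | b , crit₂ = a + b , split-critical {S} {v} {[]} {[]} v∈S ([] , []) ([] , []) crit₁ crit₂

      independent-sets : ∀ S → Σ (List (Subset N)) λ L →
        Unique L × (∀ {τ} → τ ∈ₗ L → IndIn G S τ) × (∀ {τ} → IndIn G S τ → τ ∈ₗ L)
      independent-sets S with list-independent ∣ S ∣ S ℕP.≤-refl
      ... | _ , (L , unique , char , _) =
        L , unique , (λ {τ} τ∈ → proj₁ (proj₁ (char τ) τ∈)) , (λ {τ} ind → proj₂ (char τ) (ind , λ ()))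

      -- The cone lemma: if v ∈ S has no neighbour in S, pairing each σ ∈ Ind(G[S ∖ v])
      -- with σ ∪ {v} matches all of Ind(G[S]) acyclically, so c(G[S]) = 0.
      cone : ∀ {S v} → v ∈ S → (∀ {u} → u ∈ S → adj G v u ≡ false) → cAtMost G S 0
      cone {S} {v} v∈S isolated with independent-sets (S - v)
      ... | L , unique-L , in-L⁻ , in-L⁺ =
        M , (pairs , cone-cells-unique v L unique-L v∉L) , cone-acyclic v L v∉L ,
        ([] , [] , (λ τ → (λ ()) , complete τ) , z≤n)
        where
        v∉L : ∀ {σ} → σ ∈ₗ L → v ∉ σ
        v∉L σ∈ = v∉-delete (in-L⁻ σ∈)
        M : List (Pair N)
        M = map (cone-pair v) L

        -- v is isolated, so removing it removes its closed neighbourhood.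
        link : ∀ {σ} → IndIn G (S - v) σ → IndIn G (S ─ N[ v ]) σ
        link (σ⊆ , ind) = (λ x∈ → let (x∈S , x≢v) = ∈-delete⁻ (σ⊆ x∈) in ∈-─N⁺ x∈S x≢v (isolated x∈S)) , ind
        pairs : All (λ p → proj₂ p ∉ proj₁ p × IndIn G S (top p)) M
        pairs = All.map⁺ (All.tabulate (λ σ∈ → v∉L σ∈ , insert-independent v∈S (link (in-L⁻ σ∈))))

        complete : ∀ τ → IndIn G S τ × ¬ Covered M τ → τ ∈ₗ []
        complete τ (ind , uncovered) with v ∈? τ
        ... | yes v∈τ = ⊥-elim (uncovered (subst (Covered M) (insert-delete v∈τ)
                          (top∈ends (∈-map⁺ (cone-pair v) (in-L⁺ (independent-delete v∉τ-v (independent-⊆ (p─q⊆p τ ⁅ v ⁆) ind)))))))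
          where
          v∉τ-v : v ∉ τ - v
          v∉τ-v v∈ = proj₂ (∈-delete⁻ v∈) refl
        ... | no v∉τ = ⊥-elim (uncovered (bot∈ends (∈-map⁺ (cone-pair v) (in-L⁺ (independent-delete v∉τ ind)))))

-- Induced paths of C: the path bound c(G[S]) ≤ c · val(pattern).
module Paths {N : ℕ} (G : Graph N) (C : Subset N) (c : ℕ)
             (hyp : ∀ (S : Subset N) → S ⊆ ∁ C → cAtMost G S c) where
  open import Defs renaming (sym to adj-sym)
  open import Data.Nat using (ℕ; _*_; z≤n)
  open import Data.Fin.Subset using (Subset; _∈_; _∉_; _⊆_; _─_; _-_; ∁)

  open Sets
  open Matchings
  open Scan using (val; val₁)
  import Data.Nat.Properties as ℕP
  open import Data.Bool using (Bool; true; false; _∧_; not; T)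
  open import Data.Bool.Properties using (T-≡; T-∧; T-not-≡)
  open import Data.Fin using (Fin)
  open import Data.Fin.Subset.Properties using (_∈?_; x∉p⇒x∈∁p; ⊆-antisym)
  open import Data.Vec using (lookup)
  open import Data.Vec.Properties using ([]=⇒lookup; lookup⇒[]=; lookup∘tabulate)
  open import Data.List using (List; []; _∷_; map; drop; take)
  open import Data.List.Membership.Propositional using () renaming (_∈_ to _∈ₗ_; _∉_ to _∉ₗ_)
  open import Data.List.Membership.Propositional.Properties using (∈-allFin)
  open import Data.List.Relation.Unary.Any as Any using (here; there)
  open import Data.List.Relation.Unary.Any.Properties using (any⁺)
  open import Data.List.Relation.Unary.All as All using (All; []; _∷_)
  open import Data.List.Relation.Unary.Unique.Propositional using (Unique)
  open import Data.List.Relation.Unary.Unique.Propositional.Properties using (Unique[x∷xs]⇒x∉xs)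
  open import Data.List.Relation.Unary.AllPairs using ([]; _∷_)
  open import Data.Product using (_,_; proj₁; proj₂)
  open import Data.Empty using (⊥; ⊥-elim)
  open import Function.Bundles using (Equivalence)
  open import Relation.Nullary using (yes; no)
  open import Relation.Binary.PropositionalEquality

  open Neighbourhood G

  attached : Fin N → Bool
  attached x = lookup (attach G C) x

  attach⁺ : ∀ {x u} → x ∈ C → u ∉ C → adj G x u ≡ true → attached x ≡ true
  attach⁺ {x} {u} x∈C u∉C xu =
    trans (lookup∘tabulate _ x)
          (Equivalence.to T-≡ (Equivalence.from T-∧ (Equivalence.from T-≡ ([]=⇒lookup x∈C) ,
                                                   any⁺ _ (Any.map edge-out (∈-allFin u)))))
    where
    u-outside : lookup C u ≡ false
    u-outside with lookup C u in e
    ... | true = ⊥-elim (u∉C (lookup⇒[]= u C e))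
    ... | false = refl
    edge-out : ∀ {w} → u ≡ w → T (not (lookup C w) ∧ adj G x w)
    edge-out refl = Equivalence.from T-∧ (Equivalence.from T-not-≡ u-outside , Equivalence.from T-≡ xu)

  unattached-closed : ∀ {x u} → x ∈ C → attached x ≡ false → adj G x u ≡ true → u ∈ C
  unattached-closed {u = u} x∈C unattached xu with u ∈? C
  ... | yes u∈C = u∈C
  ... | no u∉C with trans (sym (attach⁺ x∈C u∉C xu)) unattached
  ... | ()

  data InducedPath : List (Fin N) → Set where
    empty : InducedPath []
    single : ∀ {x} → InducedPath (x ∷ [])
    extend : ∀ {x y r} → adj G x y ≡ true → All (λ u → adj G x u ≡ false) r →
             InducedPath (y ∷ r) → InducedPath (x ∷ y ∷ r)

  induced-drop : ∀ {xs} → InducedPath xs → InducedPath (drop 1 xs)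
  induced-drop empty = empty
  induced-drop single = empty
  induced-drop (extend _ _ P) = P

  record PathOf (S : Subset N) (xs : List (Fin N)) : Set where
    field
      unique : Unique xs
      induced : InducedPath xs
      in-C : All (_∈ C) xs
      covers : ∀ {u} → u ∈ S → u ∈ C → u ∈ₗ xs
      within : ∀ {u} → u ∈ₗ xs → u ∈ S
  open PathOf

  path-delete : ∀ {S x r} → PathOf S (x ∷ r) → PathOf (S - x) r
  path-delete {S} {x} {r} P = record
    { unique = drop-unique (unique P) ; induced = induced-drop (induced P) ; in-C = All.tail (in-C P)
    ; covers = covers′ ; within = λ u∈r → ∈-delete⁺ (within P (there u∈r)) λ { refl → Unique[x∷xs]⇒x∉xs (unique P) u∈r } }
    where
    drop-unique : ∀ {x r} → Unique (x ∷ r) → Unique r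
    drop-unique (_ ∷ u) = u
    covers′ : ∀ {u} → u ∈ S - x → u ∈ C → u ∈ₗ r
    covers′ u∈ u∈C with ∈-delete⁻ u∈ | covers P (proj₁ (∈-delete⁻ u∈)) u∈C
    ... | _ , u≢x | here u≡x = ⊥-elim (u≢x u≡x)
    ... | _ | there u∈r = u∈r

  path-link : ∀ {S x r} → PathOf S (x ∷ r) → PathOf (S ─ N[ x ]) (drop 1 r)
  path-link {S} {x} {[]} P = record
    { unique = [] ; induced = empty ; in-C = [] ; covers = covers′ ; within = λ () }
    where
    covers′ : ∀ {u} → u ∈ S ─ N[ x ] → u ∈ C → u ∈ₗ []
    covers′ u∈ u∈C with covers P (proj₁ (∈-─N⁻ u∈)) u∈C
    ... | here u≡x = ⊥-elim (proj₁ (proj₂ (∈-─N⁻ u∈)) u≡x)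
  path-link {S} {x} {y ∷ r} P with induced P | unique P | in-C P
  ... | extend xy x≁r induced-r | (x∉ ∷ _ ∷ unique-r) | (_ ∷ _ ∷ in-C-r) = record
    { unique = unique-r ; induced = induced-drop induced-r ; in-C = in-C-r ; covers = covers′ ; within = within′ }
    where
    covers′ : ∀ {u} → u ∈ S ─ N[ x ] → u ∈ C → u ∈ₗ r
    covers′ u∈ u∈C with ∈-─N⁻ u∈ | covers P (proj₁ (∈-─N⁻ u∈)) u∈C
    ... | _ , u≢x , _ | here u≡x = ⊥-elim (u≢x u≡x)
    ... | _ , _ , x≁u | there (here refl) with trans (sym xy) x≁u
    ... | ()
    covers′ u∈ u∈C | _ | there (there u∈r) = u∈r
    within′ : ∀ {u} → u ∈ₗ r → u ∈ S ─ N[ x ]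
    within′ u∈r = ∈-─N⁺ (within P (there (there u∈r))) (λ { refl → All.lookup x∉ (there u∈r) refl }) (All.lookup x≁r u∈r)

  delete-─N : ∀ {S x y} → adj G y x ≡ true → (S - x) ─ N[ y ] ≡ S ─ N[ y ]
  delete-─N {S} {x} {y} yx = ⊆-antisym forward backward
    where
    forward : (S - x) ─ N[ y ] ⊆ S ─ N[ y ]
    forward u∈ = let (u∈S-x , u≢y , y≁u) = ∈-─N⁻ u∈ in ∈-─N⁺ (proj₁ (∈-delete⁻ u∈S-x)) u≢y y≁u
    backward : S ─ N[ y ] ⊆ (S - x) ─ N[ y ]
    backward u∈ with ∈-─N⁻ u∈
    ... | u∈S , u≢y , y≁u = ∈-─N⁺ (∈-delete⁺ u∈S λ u≡x → not-both (subst (λ w → adj G y w ≡ false) u≡x y≁u)) u≢y y≁u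
      where
      not-both : adj G y x ≡ false → ⊥
      not-both y≁x with trans (sym yx) y≁x
      ... | ()

  path-link₂ : ∀ {S x y r} → PathOf S (x ∷ y ∷ r) → PathOf (S ─ N[ y ]) (drop 1 r)
  path-link₂ {S} {x} {y} {r} P with induced P
  ... | extend xy _ _ = subst (λ T → PathOf T (drop 1 r)) (delete-─N (trans (adj-sym G y x) xy)) (path-link (path-delete P))

  first-isolated : ∀ {S x r} → PathOf S (x ∷ r) → attached x ≡ false →
                   ∀ {u} → u ∈ S → u ∉ₗ take 1 r → adj G x u ≡ false
  first-isolated {S} {x} {r} P unattached {u} u∈S u∉ with adj G x u in xu
  ... | false = refl
  ... | true = ⊥-elim (not-neighbour (covers P u∈S (unattached-closed (All.head (in-C P)) unattached xu)) (induced P))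
    where
    not-neighbour : u ∈ₗ x ∷ r → InducedPath (x ∷ r) → ⊥
    not-neighbour (here u≡x) _ with trans (sym xu) (subst (λ w → adj G x w ≡ false) (sym u≡x) (irrefl G x))
    ... | ()
    not-neighbour (there (here u≡y)) (extend _ _ _) = u∉ (here u≡y)
    not-neighbour (there (there u∈r)) (extend _ x≁r _) with trans (sym xu) (All.lookup x≁r u∈r)
    ... | ()

  -- The path bound c(G[S]) ≤ c · val(attachment pattern of the path): split at an
  -- attached first vertex x (val(1 ∷ s) = val s + val₁ s); for an unattached x
  -- split at its successor y, where x becomes isolated in G[S ∖ y] and G[S ∖ N[y]]
  -- keeps the path from its fourth vertex on.
  mutual
    path-bound : ∀ xs {S} → PathOf S xs → cAtMost G S (c * val (map attached xs))
    path-bound [] {S} P = cAtMost-weaken G (hyp S outside-C) (ℕP.≤-reflexive (sym (ℕP.*-identityʳ c)))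
      where
      outside-C : S ⊆ ∁ C
      outside-C {u} u∈S with u ∈? C
      ... | yes u∈C with covers P u∈S u∈C
      ... | ()
      outside-C u∈S | no u∉C = x∉p⇒x∈∁p u∉C
    path-bound (x ∷ r) P with attached x in unattached
    ... | true = cAtMost-weaken G
      (vertex-split G (within P (here refl)) (path-bound r (path-delete P)) (path-bound-drop r (path-link P)))
      (ℕP.≤-reflexive (sym (ℕP.*-distribˡ-+ c _ _)))
    path-bound (x ∷ []) P | false =
      cAtMost-weaken G (cone G (within P (here refl)) (λ u∈S → first-isolated P unattached u∈S (λ ()))) z≤n
    path-bound (x ∷ y ∷ r) {S} P | false =
      vertex-split G (within P (there (here refl))) (cone G x∈S-y x-isolated) (path-bound-drop r (path-link₂ P))
      where
      x∈S-y : x ∈ S - y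
      x∈S-y = ∈-delete⁺ (within P (here refl)) (λ x≡y → Unique[x∷xs]⇒x∉xs (unique P) (here x≡y))
      x-isolated : ∀ {u} → u ∈ S - y → adj G x u ≡ false
      x-isolated u∈ = first-isolated P unattached (proj₁ (∈-delete⁻ u∈)) λ { (here u≡y) → proj₂ (∈-delete⁻ u∈) u≡y }

    path-bound-drop : ∀ r {S} → PathOf S (drop 1 r) → cAtMost G S (c * val₁ (map attached r))
    path-bound-drop [] P = path-bound [] P
    path-bound-drop (y ∷ r) P = path-bound r P

-- Induced cycles: splitting at an attached vertex.
module Cycles {N : ℕ} (G : Graph N) (C : Subset N) (c : ℕ)
              (hyp : ∀ (S : Subset N) → S ⊆ ∁ C → cAtMost G S c) where
  open import Defs renaming (sym to adj-sym)
  open import Data.Nat using (ℕ; zero; suc; _+_; _*_; _≤_; _<_; z≤n; s≤s)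
  open import Data.Fin.Subset using (Subset; _∈_; _⊆_; _─_; _-_; ∁; ⊤; ∣_∣)

  open Sets
  open Matchings
  open Cyclic
  open Scan using (val; val₁; weight; bit; weight-snoc; cycle-bound)
  open Paths G C c hyp
  import Data.Nat.Properties as ℕP
  open import Data.Bool as Bool using (Bool; true; false)
  open import Data.Bool.Properties using (¬-not)
  open import Data.Fin using (Fin; toℕ; fromℕ<) renaming (zero to fzero)
  open import Data.Fin.Properties using (toℕ-fromℕ<; toℕ-injective; toℕ<n; any?)
  open import Data.Fin.Subset.Properties using (∈⊤; x∈p⇒∣p-x∣<∣p∣)
  open import Data.List using (List; []; _∷_; _++_; map)
  open import Data.List.Properties using (map-++; map-cong-local)
  open import Data.List.Membership.Propositional using () renaming (_∈_ to _∈ₗ_)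
  open import Data.List.Membership.Propositional.Properties using (∈-map⁺; ∈-map⁻)
  open import Data.List.Relation.Unary.All as All using (All)
  open import Data.List.Relation.Unary.Unique.Propositional using (Unique)
  open import Data.List.Relation.Unary.AllPairs using ([]; _∷_)
  open import Data.Vec using (lookup)
  open import Data.Vec.Properties using (lookup⇒[]=)
  open import Data.List.Relation.Unary.Unique.Propositional.Properties using () renaming (map⁺ to unique-map⁺)
  open import Data.Product using (Σ; ∃; _,_; proj₁; proj₂)
  open import Data.Sum using (_⊎_; inj₁; inj₂)
  open import Data.Empty using (⊥; ⊥-elim)
  open import Relation.Binary.PropositionalEquality
  open import Relation.Nullary.Decidable using (recompute)
  open import Relation.Nullary using (yes; no)
  open import Function.Definitions using (Injective)

  open Neighbourhood G

  weight-≤ : ∀ (A : Subset N) ys → Unique ys → weight (map (lookup A) ys) ≤ ∣ A ∣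
  weight-≤ A [] _ = z≤n
  weight-≤ A (y ∷ ys) (y∉ys ∷ unique) with lookup A y in y∈A
  ... | false = weight-≤ A ys unique
  ... | true = ℕP.≤-trans (s≤s (ℕP.≤-trans (ℕP.≤-reflexive (cong weight same-lookups)) (weight-≤ (A - y) ys unique)))
                         (x∈p⇒∣p-x∣<∣p∣ (lookup⇒[]= y A y∈A))
    where
    same-lookups : map (lookup A) ys ≡ map (lookup (A - y)) ys
    same-lookups = map-cong-local (All.map (λ {x} y≢x → lookup-cong x (λ x∈ → ∈-delete⁺ x∈ (λ x≡y → y≢x (sym x≡y)))
                                                                         (λ x∈ → proj₁ (∈-delete⁻ {v = y} {σ = A} x∈))) y∉ys)

  record Enumeration (K : ℕ) : Set where
    field
      vertex : Fin K → Fin N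
      injective : Injective _≡_ _≡_ vertex
      onto : ∀ {v} → v ∈ C → ∃ λ i → vertex i ≡ v
      in-C : ∀ i → vertex i ∈ C
      adjacent : ∀ i j → adj G (vertex i) (vertex j) ≡ true → j ≡ next i ⊎ i ≡ next j
      consecutive : ∀ i → adj G (vertex i) (vertex (next i)) ≡ true

  rotate : ∀ {m} → Enumeration (suc m) → ℕ → Enumeration (suc m)
  rotate E r = record
    { vertex = λ i → vertex (shift r i)
    ; injective = λ e → shift-injective r (injective e)
    ; onto = onto′
    ; in-C = λ i → in-C (shift r i)
    ; adjacent = adjacent′
    ; consecutive = λ i → subst (λ j → adj G (vertex (shift r i)) (vertex j) ≡ true) (sym (shift-next r i)) (consecutive (shift r i))
    }
    where
    open Enumeration E
    onto′ : ∀ {v} → v ∈ C → ∃ λ i → vertex (shift r i) ≡ v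
    onto′ v∈C with onto v∈C
    ... | j , refl with shift-surjective r j
    ... | i , refl = i , refl
    adjacent′ : ∀ i j → adj G (vertex (shift r i)) (vertex (shift r j)) ≡ true → j ≡ next i ⊎ i ≡ next j
    adjacent′ i j e with adjacent (shift r i) (shift r j) e
    ... | inj₁ e′ = inj₁ (shift-injective r (trans e′ (sym (shift-next r i))))
    ... | inj₂ e′ = inj₂ (shift-injective r (trans e′ (sym (shift-next r j))))

  -- Splitting a cycle of length 3 + k at vertex 0: G[⊤ ∖ vertex 0] contains the
  -- path vertex 1, …, vertex (k+2) and G[⊤ ∖ N[vertex 0]] the path vertex 2, …,
  -- vertex (k+1), each covering the part of C that survives.
  module Split {k : ℕ} (E : Enumeration (3 + k)) where
    open Enumeration E
    open Range (3 + k)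

    K : ℕ
    K = 3 + k

    next-fromℕ< : ∀ a (lt : a < K) (lt′ : suc a < K) → next (fromℕ< lt) ≡ fromℕ< lt′
    next-fromℕ< a lt lt′ = toℕ-injective (begin
      toℕ (next (fromℕ< lt)) ≡⟨ next-toℕ (fromℕ< lt) (subst (_< 2 + k) (sym (toℕ-fromℕ< lt)) (ℕP.≤-pred lt′)) ⟩
      suc (toℕ (fromℕ< lt))  ≡⟨ cong suc (toℕ-fromℕ< lt) ⟩
      suc a                  ≡⟨ sym (toℕ-fromℕ< lt′) ⟩
      toℕ (fromℕ< lt′)       ∎)
      where open ≡-Reasoning

    far : ∀ (i j : Fin K) → 1 ≤ toℕ i → 2 + toℕ i ≤ toℕ j → adj G (vertex i) (vertex j) ≡ false
    far i j 1≤i i+2≤j with adj G (vertex i) (vertex j) in e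
    ... | false = refl
    ... | true = ⊥-elim (not-consecutive (adjacent i j e))
      where
      not-consecutive : j ≡ next i ⊎ i ≡ next j → ⊥
      not-consecutive (inj₁ refl) with next-cases i
      ... | inj₁ e′ = ℕP.<-irrefl (sym e′) i+2≤j
      ... | inj₂ (_ , e′) = ℕP.<-irrefl (sym e′) (ℕP.<-≤-trans (s≤s z≤n) i+2≤j)
      not-consecutive (inj₂ refl) with next-cases j
      ... | inj₁ e′ = ℕP.<-irrefl refl (ℕP.<-≤-trans (subst (λ t → toℕ j < 2 + t) (sym e′) (ℕP.≤-trans (ℕP.n<1+n (toℕ j)) (ℕP.m≤n+m _ 2))) i+2≤j)
      ... | inj₂ (_ , e′) = ℕP.<-irrefl (sym e′) 1≤i

    -- The first index of a nonempty range, as a relevant proof.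
    index< : ∀ a len .(h : a + suc len ≤ K) → a < K
    index< a len h = recompute (a ℕP.<? K) (ℕP.<-≤-trans (ℕP.m<m+n a (s≤s z≤n)) h)

    range-induced : ∀ a len .(h : a + len ≤ K) → 1 ≤ a → InducedPath (map vertex (range a len h))
    range-induced a zero h _ = empty
    range-induced a (suc zero) h _ = single
    range-induced a (suc (suc len)) h 1≤a =
      extend step beyond (range-induced (suc a) (suc len) (step-bound a (suc len) h) (ℕP.m≤n⇒m≤1+n 1≤a))
      where
      i : Fin K
      i = fromℕ< (index< a (suc len) h)
      step : adj G (vertex i) (vertex (fromℕ< (index< (suc a) len (step-bound a (suc len) h)))) ≡ true
      step = subst (λ j → adj G (vertex i) (vertex j) ≡ true)
                   (next-fromℕ< a (index< a (suc len) h) (index< (suc a) len (step-bound a (suc len) h)))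
                   (consecutive i)
      beyond : All (λ u → adj G (vertex i) u ≡ false)
                   (map vertex (range (2 + a) len (step-bound (suc a) len (step-bound a (suc len) h))))
      beyond = All.tabulate far-member
        where
        far-member : ∀ {u} → u ∈ₗ map vertex (range (2 + a) len (step-bound (suc a) len (step-bound a (suc len) h))) → adj G (vertex i) u ≡ false
        far-member u∈ with ∈-map⁻ vertex u∈
        ... | j , j∈ , refl = far i j (subst (1 ≤_) (sym (toℕ-fromℕ< _)) 1≤a)
                                      (subst (λ t → 2 + t ≤ toℕ j) (sym (toℕ-fromℕ< _)) (proj₁ (∈-range⁻ (2 + a) len (step-bound (suc a) len (step-bound a (suc len) h)) j∈)))

    range-unique′ : ∀ a len .(h : a + len ≤ K) → Unique (map vertex (range a len h))
    range-unique′ a len h = unique-map⁺ injective (range-unique a len h)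

    range-in-C : ∀ a len .(h : a + len ≤ K) → All (_∈ C) (map vertex (range a len h))
    range-in-C a len h = All.tabulate λ u∈ → let (j , _ , u≡) = ∈-map⁻ vertex u∈ in subst (_∈ C) (sym u≡) (in-C j)

    v₀ : Fin N
    v₀ = vertex fzero

    toℕ≢0 : ∀ {i} → vertex i ≢ v₀ → toℕ i ≢ 0
    toℕ≢0 vi≢v₀ i≡0 = vi≢v₀ (cong vertex (toℕ-injective i≡0))

    path₁ : PathOf (⊤ - v₀) (map vertex (range 1 (2 + k) ℕP.≤-refl))
    path₁ = record
      { unique = range-unique′ 1 (2 + k) ℕP.≤-refl ; induced = range-induced 1 (2 + k) ℕP.≤-refl ℕP.≤-refl
      ; in-C = range-in-C 1 (2 + k) ℕP.≤-refl ; covers = covers′ ; within = within′ }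
      where
      covers′ : ∀ {u} → u ∈ ⊤ - v₀ → u ∈ C → u ∈ₗ map vertex (range 1 (2 + k) ℕP.≤-refl)
      covers′ u∈ u∈C with onto u∈C
      ... | i , refl = ∈-map⁺ vertex (∈-range⁺ 1 (2 + k) ℕP.≤-refl (ℕP.n≢0⇒n>0 (toℕ≢0 (proj₂ (∈-delete⁻ u∈)))) (toℕ<n i))
      within′ : ∀ {u} → u ∈ₗ map vertex (range 1 (2 + k) ℕP.≤-refl) → u ∈ ⊤ - v₀
      within′ u∈ with ∈-map⁻ vertex u∈
      ... | j , j∈ , refl =
        ∈-delete⁺ ∈⊤ λ vj≡v₀ → ℕP.<-irrefl (sym (cong toℕ (injective vj≡v₀))) (proj₁ (∈-range⁻ 1 (2 + k) ℕP.≤-refl j∈))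

    bound₂ : 2 + k ≤ K
    bound₂ = ℕP.n≤1+n (2 + k)

    path₂ : PathOf (⊤ ─ N[ v₀ ]) (map vertex (range 2 k bound₂))
    path₂ = record
      { unique = range-unique′ 2 k bound₂ ; induced = range-induced 2 k bound₂ (s≤s z≤n)
      ; in-C = range-in-C 2 k bound₂ ; covers = covers′ ; within = within′ }
      where
      covers′ : ∀ {u} → u ∈ ⊤ ─ N[ v₀ ] → u ∈ C → u ∈ₗ map vertex (range 2 k bound₂)
      covers′ u∈ u∈C with onto u∈C
      ... | i , refl with ∈-─N⁻ u∈
      ... | _ , vi≢v₀ , v₀≁vi = ∈-map⁺ vertex (∈-range⁺ 2 k bound₂ 2≤i i<2+k)
        where
        i≢1 : toℕ i ≢ 1
        i≢1 i≡1 with trans (sym (subst (λ j → adj G v₀ (vertex j) ≡ true) (toℕ-injective (trans (next-toℕ {2 + k} fzero (s≤s z≤n)) (sym i≡1))) (consecutive fzero))) v₀≁vi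
        ... | ()
        2≤i : 2 ≤ toℕ i
        2≤i with toℕ i | toℕ≢0 vi≢v₀ | i≢1
        ... | zero | ≢0 | _ = ⊥-elim (≢0 refl)
        ... | suc zero | _ | ≢1 = ⊥-elim (≢1 refl)
        ... | suc (suc _) | _ | _ = s≤s (s≤s z≤n)
        i≢last : toℕ i ≢ 2 + k
        i≢last i≡last with trans (sym (trans (adj-sym G v₀ (vertex i)) (subst (λ j → adj G (vertex i) (vertex j) ≡ true) (toℕ-injective (next-last i i≡last)) (consecutive i)))) v₀≁vi
        ... | ()
        i<2+k : toℕ i < 2 + k
        i<2+k = ℕP.≤∧≢⇒< (ℕP.≤-pred (toℕ<n i)) i≢last
      within′ : ∀ {u} → u ∈ₗ map vertex (range 2 k bound₂) → u ∈ ⊤ ─ N[ v₀ ]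
      within′ u∈ with ∈-map⁻ vertex u∈
      ... | j , j∈ , refl with ∈-range⁻ 2 k bound₂ j∈
      ... | 2≤j , j<2+k = ∈-─N⁺ ∈⊤ (λ vj≡v₀ → ℕP.<-irrefl (sym (cong toℕ (injective vj≡v₀))) (ℕP.<-trans (s≤s z≤n) 2≤j)) v₀≁vj
        where
        not-consecutive : j ≡ next fzero ⊎ fzero ≡ next j → ⊥
        not-consecutive (inj₁ refl) = ℕP.<-irrefl (sym (next-toℕ {2 + k} fzero (s≤s z≤n))) 2≤j
        not-consecutive (inj₂ 0≡next) = ℕP.1+n≢0 (trans (sym (next-toℕ j j<2+k)) (sym (cong toℕ 0≡next)))
        v₀≁vj : adj G v₀ (vertex j) ≡ false
        v₀≁vj with adj G v₀ (vertex j) in e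
        ... | false = refl
        ... | true = ⊥-elim (not-consecutive (adjacent fzero j e))

    pattern₁ : List Bool
    pattern₁ = map attached (map vertex (range 1 (suc k) bound₂))

    last : Bool
    last = attached (vertex (fromℕ< {2 + k} ℕP.≤-refl))

    -- The path after deleting vertex 0 has pattern pattern₁ ++ [last]; the path
    -- after deleting N[vertex 0] is pattern₁ without its head, of value val₁ pattern₁.
    path₁-pattern : map attached (map vertex (range 1 (2 + k) ℕP.≤-refl)) ≡ pattern₁ ++ last ∷ []
    path₁-pattern = begin
      map attached (map vertex (range 1 (2 + k) ℕP.≤-refl))
        ≡⟨ cong (λ is → map attached (map vertex is)) (range-snoc 1 (suc k) ℕP.≤-refl bound₂ ℕP.≤-refl) ⟩
      map attached (map vertex (range 1 (suc k) bound₂ ++ fromℕ< {2 + k} ℕP.≤-refl ∷ []))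
        ≡⟨ cong (map attached) (map-++ vertex (range 1 (suc k) bound₂) _) ⟩
      map attached (map vertex (range 1 (suc k) bound₂) ++ vertex (fromℕ< {2 + k} ℕP.≤-refl) ∷ [])
        ≡⟨ map-++ attached (map vertex (range 1 (suc k) bound₂)) _ ⟩
      pattern₁ ++ last ∷ [] ∎
      where open ≡-Reasoning

    split : cAtMost G ⊤ (c * val (pattern₁ ++ last ∷ []) + c * val₁ pattern₁)
    split = subst (λ s → cAtMost G ⊤ (c * val s + c * val₁ pattern₁)) path₁-pattern
                  (vertex-split G ∈⊤ (path-bound _ path₁) (path-bound _ path₂))

    attached-count : attached v₀ ≡ true → 1 + (weight pattern₁ + bit last) ≤ ∣ attach G C ∣
    attached-count v₀-attached = begin
      1 + (weight pattern₁ + bit last)      ≡⟨ cong (1 +_) (sym (weight-snoc pattern₁ last)) ⟩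
      1 + weight (pattern₁ ++ last ∷ [])    ≡⟨ cong₂ (λ b s → bit b + weight s) (sym v₀-attached) (sym path₁-pattern) ⟩
      weight (map attached (map vertex (range 0 K ℕP.≤-refl))) ≤⟨ weight-≤ (attach G C) _ (range-unique′ 0 K ℕP.≤-refl) ⟩
      ∣ attach G C ∣                        ∎
      where open ℕP.≤-Reasoning

    unattached-weight : (∀ i → attached (vertex i) ≡ false) → ∀ is → weight (map attached (map vertex is)) ≡ 0
    unattached-weight none [] = refl
    unattached-weight none (i ∷ is) = cong₂ (λ b w → bit b + w) (none i) (unattached-weight none is)

    count-bound : ∀ n → 2 ≤ n → ∣ attach G C ∣ ≤ n → (attached v₀ ≡ true ⊎ (∀ i → attached (vertex i) ≡ false)) →
                  weight pattern₁ + 1 + bit last ≤ n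
    count-bound n _ ∣A∣≤n (inj₁ v₀-attached) =
      ℕP.≤-trans (ℕP.≤-reflexive (rearrange (weight pattern₁) (bit last))) (ℕP.≤-trans (attached-count v₀-attached) ∣A∣≤n)
      where
      rearrange : ∀ w b → w + 1 + b ≡ 1 + (w + b)
      rearrange w b = cong (_+ b) (ℕP.+-comm w 1)
    count-bound n 2≤n _ (inj₂ none) =
      subst (_≤ n) (sym (cong₂ (λ w b → w + 1 + b) (unattached-weight none (range 1 (suc k) bound₂)) (cong bit (none _))))
            (ℕP.≤-trans (s≤s z≤n) 2≤n)

    cycle-split-bound : ∀ n → 2 ≤ n → ∣ attach G C ∣ ≤ n → (attached v₀ ≡ true ⊎ (∀ i → attached (vertex i) ≡ false)) →
                        cAtMost G ⊤ (c * lucas n)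
    cycle-split-bound n 2≤n ∣A∣≤n start =
      cAtMost-weaken G split (ℕP.≤-trans (ℕP.≤-reflexive (sym (ℕP.*-distribˡ-+ c _ _)))
                                         (ℕP.*-monoʳ-≤ c (cycle-bound pattern₁ last n 2≤n (count-bound n 2≤n ∣A∣≤n start))))

  enumerate : IsInducedCycle G C → Σ ℕ λ k → Enumeration (3 + k)
  enumerate (suc zero , s≤s () , _)
  enumerate (suc (suc zero) , s≤s (s≤s ()) , _)
  enumerate (suc (suc (suc k)) , _ , v , v-injective , members , adjacency) = k , record
    { vertex = v ; injective = v-injective
    ; onto = λ {u} u∈C → proj₁ (members u) u∈C
    ; in-C = λ i → proj₂ (members (v i)) (i , refl)
    ; adjacent = λ i j → proj₁ (adjacency i j)
    ; consecutive = λ i → proj₂ (adjacency i (next i)) (inj₁ refl) }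

  attached-start : ∀ {k} → Enumeration (3 + k) → Σ (Enumeration (3 + k)) λ E →
                   attached (Enumeration.vertex E fzero) ≡ true ⊎ (∀ i → attached (Enumeration.vertex E i) ≡ false)
  attached-start E with any? (λ i → attached (Enumeration.vertex E i) Bool.≟ true)
  ... | yes (i , i-attached) =
    rotate E (toℕ i) , inj₁ (subst (λ j → attached (Enumeration.vertex E j) ≡ true) (sym (shift-from-zero i)) i-attached)
  ... | no none = E , inj₂ λ i → ¬-not (λ i-attached → none (i , i-attached))

open import Defs
open import Data.Nat using (ℕ; _≤_; _*_)
open import Data.Fin.Subset using (Subset; _⊆_; ∁; ⊤; ∣_∣)
open import Data.Product using (_,_)

theorem3p4 : ∀ {N} (G : Graph N) (C : Subset N) (n c : ℕ) →
    2 ≤ n → IsInducedCycle G C → ∣ attach G C ∣ ≤ n →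
    (∀ (S : Subset N) → S ⊆ ∁ C → cAtMost G S c) →
    cAtMost G ⊤ (c * lucas n)
theorem3p4 G C n c 2≤n cycle ∣A∣≤n hyp =
  let open Cycles G C c hyp
      (k , E) = enumerate cycle
      (E′ , start) = attached-start E
  in Split.cycle-split-bound E′ n 2≤n ∣A∣≤n start
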